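{- If $X$ is a Hamilton-decomposable graph, then the complete generalized truncation of $X$ is also Hamilton-decomposable.
   Context: Generalized truncation of a graph $X$ (without isolated vertices): take a matching $M_0$ with $|M_0|=|E(X)|$ (on $2|E(X)|$ new vertices) and a bijection $F:E(X)\to M_0$; for each edge $e$ of $X$ with ends $u,v$, label one end of $F(e)$ by $u$ and the other by $v$. For $v\in V(X)$, the cluster $\mathrm{cl}(v)$ is the set of vertices labelled $v$; insert a graph $\mathrm{con}(v)$ (constituent) on $\mathrm{cl}(v)$. The result $F(M_0)\cup\bigcup_v\mathrm{con}(v)$ is a generalized truncation; it is the complete generalized truncation if every constituent is a complete graph. A regular graph is Hamilton-decomposable if its edge set can be partitioned into Hamilton cycles when its valency is even, and into Hamilton cycles and a single perfect matching when its valency is odd. -}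

module Defs where

open import Data.Nat using (ℕ; zero; suc; _≤_; _+_)
open import Data.Nat.DivMod using (_%_; _/_)
open import Data.Fin using (Fin; toℕ; _≟_)
open import Data.Bool using (Bool; true; false; _∨_; _∧_; not; if_then_else_)
open import Data.List using (map; allFin)
open import Data.Nat.ListAction using (sum)
open import Data.Maybe using (Maybe; just; nothing)
open import Data.Product using (Σ; ∃; ∃-syntax; _×_; _,_)
open import Data.Sum using (_⊎_)
open import Relation.Nullary using (¬_)
open import Relation.Nullary.Decidable using (⌊_⌋)
open import Relation.Binary.PropositionalEquality using (_≡_; _≢_)
open import Function.Bundles using (_⇔_)
open import Function.Definitions using (Injective)

Adj : ℕ → Set
Adj n = Fin n → Fin n → Bool

IsSimple : ∀ {n} → Adj n → Set
IsSimple {n} A = (∀ u v → A u v ≡ A v u) × (∀ u → A u u ≡ false)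

NoIsolated : ∀ {n} → Adj n → Set
NoIsolated {n} A = ∀ u → ∃[ v ] A u v ≡ true

deg : ∀ {n} → Adj n → Fin n → ℕ
deg {n} A u = sum (map (λ v → if A u v then 1 else 0) (allFin n))

Regular : ∀ {n} → Adj n → ℕ → Set
Regular A k = ∀ u → deg A u ≡ k

Consec : (n : ℕ) → Fin n → Fin n → Set
Consec n i j = (suc (toℕ i) ≡ toℕ j) ⊎ ((suc (toℕ i) ≡ n) × (toℕ j ≡ 0))

IsHamCycle : (n : ℕ) → (Fin n → Fin n → Set) → Set
IsHamCycle n H =
  (3 ≤ n) × Σ (Fin n → Fin n) λ f → Injective _≡_ _≡_ f ×
    (∀ u v → H u v ⇔ (∃[ i ] ∃[ j ] Consec n i j ×
                        ((f i ≡ u × f j ≡ v) ⊎ (f i ≡ v × f j ≡ u))))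

IsPerfectMatching : (n : ℕ) → (Fin n → Fin n → Set) → Set
IsPerfectMatching n H = ∀ u → ∃[ v ] (H u v × (∀ w → H u w → w ≡ v))

-- A Hamilton decomposition of a k-regular graph A: a partition of the edge
-- set into classes indexed by Maybe (Fin r) (an edge colouring, symmetric in
-- the two ends); each class `just i` is a Hamilton cycle, and the class
-- `nothing` is empty when k is even and is a perfect matching when k is odd.
record HamDecomposition {n : ℕ} (A : Adj n) (k : ℕ) : Set where
  field
    r      : ℕ
    colour : ∀ u v → A u v ≡ true → Maybe (Fin r)
    colour-sym : ∀ u v (p : A u v ≡ true) (q : A v u ≡ true) →
                 colour u v p ≡ colour v u q
  Class : Maybe (Fin r) → Fin n → Fin n → Set
  Class c u v = Σ (A u v ≡ true) λ p → colour u v p ≡ c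
  field
    cycles : ∀ i → IsHamCycle n (Class (just i))
    rest   : ((k % 2 ≡ 0) × (∀ u v → ¬ Class nothing u v))
           ⊎ ((k % 2 ≡ 1) × IsPerfectMatching n (Class nothing))

HamDecomposable : ∀ {n} → Adj n → Set
HamDecomposable A = ∃[ k ] (Regular A k × HamDecomposition A k)

-- Data of a complete generalized truncation of a graph X on Fin n, with new
-- vertex set Fin m: `lab y` is the label (vertex of X) of the new vertex y,
-- and `partner y` is the other end of the edge of M₀ containing y.
-- The bijection F : E(X) → M₀ is encoded by: each M₀-edge {y, partner y}
-- has ends labelled by the two ends of an edge of X, and for each edge uv of
-- X there is exactly one M₀-edge whose ends are labelled u and v.
record GenTruncData {n : ℕ} (X : Adj n) (m : ℕ) : Set where
  field
    lab     : Fin m → Fin n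
    partner : Fin m → Fin m
    partner-invol : ∀ y → partner (partner y) ≡ y
    partner-edge  : ∀ y → X (lab y) (lab (partner y)) ≡ true
    partner-unique : ∀ u v → X u v ≡ true →
      ∃[ y ] ((lab y ≡ u × lab (partner y) ≡ v) ×
              (∀ z → lab z ≡ u → lab (partner z) ≡ v → z ≡ y))

completeTrunc : ∀ {n m} {X : Adj n} → GenTruncData X m → Adj m
completeTrunc T y z =
  ⌊ partner y ≟ z ⌋ ∨ (⌊ lab y ≟ lab z ⌋ ∧ not ⌊ y ≟ z ⌋)
  where open GenTruncData T

module Submission where

-- Let the Hamilton decomposition of X consist of r cycles, so that every vertex v has valency
-- K = 2r + ε: its neighbours are its predecessor and its successor on each cycle and, when ε = 1,
-- its partner in the perfect matching.  Number the K vertices of the cluster cl(v) by these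
-- neighbours, the slots of v.  Walecki's construction decomposes the complete graph on K vertices
-- into r Hamilton paths, the j-th running from the predecessor slot of cycle j to its successor
-- slot, together with a perfect matching of the 2r cycle slots when K is odd.  The j-th Hamilton
-- cycle of the truncation follows cycle j of X and crosses every cluster along the j-th path; the
-- M₀-edges coming from the perfect matching of X and the leftover cluster edges form the perfect
-- matching.

open import Defs
open import Data.Nat using (ℕ)

open import Data.Nat as ℕ using (zero; suc; pred; _+_; _*_; _∸_; _≤_; _<_; z≤n; s≤s; z<s; ⌊_/2⌋; parity)
open import Data.Parity.Base using (Parity; 0ℙ; 1ℙ)
open import Data.Nat.Properties
open import Algebra.Properties.CommutativeSemigroup +-commutativeSemigroup using (interchange)
open import Data.Nat.DivMod using (_%_; %-distribˡ-+; m%n%n≡m%n; [m+n]%n≡m%n; [m+kn]%n≡m%n; m<n⇒m%n≡m; m%n<n)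
open import Data.Fin as Fin using (Fin; toℕ; fromℕ<; combine)
import Data.Fin.Properties as Finₚ
open Finₚ using (toℕ-injective; toℕ<n; toℕ-fromℕ<)
open import Data.Bool using (Bool; true; false; if_then_else_)
open import Data.Maybe using (Maybe; just; nothing)
open import Data.Maybe.Properties using (just-injective)
open import Data.List using (tabulate)
open import Data.List.Properties using (map-tabulate)
open import Data.Nat.ListAction using (sum)
open import Data.Product using (Σ; ∃; ∃-syntax; _×_; _,_; proj₁; proj₂; uncurry)
open import Function.Bundles using (_⇔_; mk⇔; Equivalence)
open import Data.Sum using (_⊎_; inj₁; inj₂)
import Data.Sum
open import Data.Empty using (⊥-elim)
open import Function using (_∘_)
open import Function.Definitions using (Injective)
open import Relation.Nullary using (¬_; Dec; yes; no)
open import Relation.Binary.PropositionalEquality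
open import Relation.Binary.Definitions using (Tri; tri<; tri≈; tri>)

just≢nothing : ∀ {A : Set} {a : A} → just a ≢ nothing
just≢nothing ()

≡true-irrelevant : ∀ {b : Bool} (p q : b ≡ true) → p ≡ q
≡true-irrelevant refl refl = refl

next : ∀ {n} → Fin n → Fin n
next {suc n} i with suc (toℕ i) ℕ.<? suc n
... | yes i+1<n = fromℕ< i+1<n
... | no _ = Fin.zero

prev : ∀ {n} → Fin n → Fin n
prev {suc n} Fin.zero = Fin.fromℕ n
prev {suc n} (Fin.suc i) = Fin.inject₁ i

consec-next : ∀ {n} (i : Fin n) → Consec n i (next i)
consec-next {suc n} i with suc (toℕ i) ℕ.<? suc n
... | yes i+1<n = inj₁ (sym (toℕ-fromℕ< i+1<n))
... | no i+1≮n = inj₂ (≤-antisym (toℕ<n i) (≮⇒≥ i+1≮n) , refl)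

consec-prev : ∀ {n} (j : Fin n) → Consec n (prev j) j
consec-prev {suc n} Fin.zero = inj₂ (cong suc (Finₚ.toℕ-fromℕ n) , refl)
consec-prev {suc n} (Fin.suc j) = inj₁ (cong suc (Finₚ.toℕ-inject₁ j))

consec-functional : ∀ {n} {i j j′ : Fin n} → Consec n i j → Consec n i j′ → j ≡ j′
consec-functional (inj₁ p) (inj₁ q) = toℕ-injective (trans (sym p) q)
consec-functional {j = j} (inj₁ p) (inj₂ (q , _)) = ⊥-elim (<-irrefl (trans (sym p) q) (toℕ<n j))
consec-functional {j′ = j′} (inj₂ (p , _)) (inj₁ q) = ⊥-elim (<-irrefl (trans (sym q) p) (toℕ<n j′))
consec-functional (inj₂ (_ , p)) (inj₂ (_ , q)) = toℕ-injective (trans p (sym q))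

consec-injective : ∀ {n} {i i′ j : Fin n} → Consec n i j → Consec n i′ j → i ≡ i′
consec-injective (inj₁ p) (inj₁ q) = toℕ-injective (suc-injective (trans p (sym q)))
consec-injective (inj₁ p) (inj₂ (_ , q)) = ⊥-elim (0≢1+n (trans (sym q) (sym p)))
consec-injective (inj₂ (_ , p)) (inj₁ q) = ⊥-elim (0≢1+n (trans (sym p) (sym q)))
consec-injective (inj₂ (p , _)) (inj₂ (q , _)) = toℕ-injective (suc-injective (trans p (sym q)))

consec⇒≡next : ∀ {n} {i j : Fin n} → Consec n i j → j ≡ next i
consec⇒≡next {i = i} c = consec-functional c (consec-next i)

consec⇒≡prev : ∀ {n} {i j : Fin n} → Consec n i j → i ≡ prev j
consec⇒≡prev {j = j} c = consec-injective c (consec-prev j)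

consec-asym : ∀ {n} {i j : Fin n} → 3 ≤ n → Consec n i j → ¬ Consec n j i
consec-asym _ (inj₁ p) (inj₁ q) = <-irrefl (sym (trans (cong suc p) q)) (<-trans (n<1+n _) (n<1+n _))
consec-asym 3≤n (inj₁ p) (inj₂ (q , j≡0)) rewrite j≡0 = <-irrefl (trans (cong suc p) q) 3≤n
consec-asym 3≤n (inj₂ (q , i≡0)) (inj₁ p) rewrite i≡0 = <-irrefl (trans (cong suc p) q) 3≤n
consec-asym 3≤n (inj₂ (_ , j≡0)) (inj₂ (q , _)) rewrite j≡0 = <-irrefl q (<-trans (s≤s (s≤s z≤n)) 3≤n)

prev≢next : ∀ {n} (i : Fin n) → 3 ≤ n → prev i ≢ next i
prev≢next i 3≤n p≡n = consec-asym 3≤n (consec-prev i) (subst (Consec _ i) (sym p≡n) (consec-next i))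

injective⇒surjective : ∀ {n} (f : Fin n → Fin n) → Injective _≡_ _≡_ f → ∀ y → ∃ λ x → f x ≡ y
injective⇒surjective {suc n} f f-inj y with Finₚ.any? (λ x → f x Fin.≟ y)
... | yes hit = hit
... | no miss = ⊥-elim (<-irrefl refl (Finₚ.injective⇒≤ punched-inj))
  where
  punched : Fin (suc n) → Fin n
  punched x = Fin.punchOut {i = y} {j = f x} (λ y≡fx → miss (x , sym y≡fx))
  punched-inj : Injective _≡_ _≡_ punched
  punched-inj {x} {x′} e = f-inj (Finₚ.punchOut-injective (λ p → miss (x , sym p)) (λ p → miss (x′ , sym p)) e)

count : ∀ {n} → (Fin n → Bool) → ℕ
count {zero} b = 0
count {suc n} b = (if b Fin.zero then 1 else 0) + count (b ∘ Fin.suc)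

deg≡count : ∀ {n} (A : Adj n) u → deg A u ≡ count (A u)
deg≡count {n} A u = trans (cong sum (map-tabulate (λ v → v) indicator)) (sum-indicator (A u))
  where
  indicator : Fin n → ℕ
  indicator v = if A u v then 1 else 0
  sum-indicator : ∀ {n} (b : Fin n → Bool) → sum (tabulate (λ v → if b v then 1 else 0)) ≡ count b
  sum-indicator {zero} b = refl
  sum-indicator {suc n} b = cong ((if b Fin.zero then 1 else 0) +_) (sum-indicator (b ∘ Fin.suc))

supportIndex : ∀ {n} (b : Fin n → Bool) (x : Fin n) → b x ≡ true → Fin (count b)
supportIndex {suc n} b Fin.zero p with b Fin.zero
supportIndex {suc n} b Fin.zero refl | true = Fin.zero
supportIndex {suc n} b (Fin.suc x) p with b Fin.zero
... | true = Fin.suc (supportIndex (b ∘ Fin.suc) x p)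
... | false = supportIndex (b ∘ Fin.suc) x p

supportIndex-injective : ∀ {n} (b : Fin n → Bool) {x y : Fin n} (p : b x ≡ true) (q : b y ≡ true) →
                         supportIndex b x p ≡ supportIndex b y q → x ≡ y
supportIndex-injective {suc n} b {Fin.zero} {Fin.zero} p q e = refl
supportIndex-injective {suc n} b {Fin.zero} {Fin.suc y} p q e with b Fin.zero
supportIndex-injective {suc n} b {Fin.zero} {Fin.suc y} refl q () | true
supportIndex-injective {suc n} b {Fin.suc x} {Fin.zero} p q e with b Fin.zero
supportIndex-injective {suc n} b {Fin.suc x} {Fin.zero} p refl () | true
supportIndex-injective {suc n} b {Fin.suc x} {Fin.suc y} p q e with b Fin.zero
... | true = cong Fin.suc (supportIndex-injective (b ∘ Fin.suc) p q (Finₚ.suc-injective e))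
... | false = cong Fin.suc (supportIndex-injective (b ∘ Fin.suc) p q e)

supportElem : ∀ {n} (b : Fin n → Bool) → Fin (count b) → Σ (Fin n) λ x → b x ≡ true
supportElemAt : ∀ {n} (b : Fin (suc n) → Bool) w → b Fin.zero ≡ w →
                Fin ((if w then 1 else 0) + count (b ∘ Fin.suc)) → Σ (Fin (suc n)) λ x → b x ≡ true
supportElem {suc n} b = supportElemAt b (b Fin.zero) refl
supportElemAt b true b0 Fin.zero = Fin.zero , b0
supportElemAt b true b0 (Fin.suc i) = let (x , p) = supportElem (b ∘ Fin.suc) i in Fin.suc x , p
supportElemAt b false b0 i = let (x , p) = supportElem (b ∘ Fin.suc) i in Fin.suc x , p

supportElem-injective : ∀ {n} (b : Fin n → Bool) {i j : Fin (count b)} →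
                        proj₁ (supportElem b i) ≡ proj₁ (supportElem b j) → i ≡ j
supportElemAt-injective : ∀ {n} (b : Fin (suc n) → Bool) w (b0 : b Fin.zero ≡ w) {i j} →
                          proj₁ (supportElemAt b w b0 i) ≡ proj₁ (supportElemAt b w b0 j) → i ≡ j
supportElem-injective {suc n} b = supportElemAt-injective b (b Fin.zero) refl
supportElemAt-injective b true b0 {Fin.zero} {Fin.zero} e = refl
supportElemAt-injective b true b0 {Fin.zero} {Fin.suc j} ()
supportElemAt-injective b true b0 {Fin.suc i} {Fin.zero} ()
supportElemAt-injective b true b0 {Fin.suc i} {Fin.suc j} e =
  cong Fin.suc (supportElem-injective (b ∘ Fin.suc) (Finₚ.suc-injective e))
supportElemAt-injective b false b0 e = supportElem-injective (b ∘ Fin.suc) (Finₚ.suc-injective e)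

count≡ : ∀ {n c} (b : Fin n → Bool) →
         (f : (x : Fin n) → b x ≡ true → Fin c) → (∀ {x y} p q → f x p ≡ f y q → x ≡ y) →
         (g : Fin c → Fin n) → (∀ s → b (g s) ≡ true) → Injective _≡_ _≡_ g →
         count b ≡ c
count≡ b f f-inj g g-supp g-inj =
  Finₚ.cantor-schröder-bernstein {f = f′} {g = g′}
    (λ e → supportElem-injective b (f-inj _ _ e)) (λ e → g-inj (supportIndex-injective b _ _ e))
  where
  f′ = λ i → f (proj₁ (supportElem b i)) (proj₂ (supportElem b i))
  g′ = λ s → supportIndex b (g s) (g-supp s)

-- Hamilton cycles through the lexicographic order on Fin (n * K)

module _ {n K : ℕ} where

  private
    suc-combine : (p : Fin n) (q : Fin K) → suc (toℕ (combine p q)) ≡ K * toℕ p + suc (toℕ q)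
    suc-combine p q = trans (cong suc (Finₚ.toℕ-combine p q)) (sym (+-suc (K * toℕ p) (toℕ q)))

    suc-combine-last : (p : Fin n) {q : Fin K} → suc (toℕ q) ≡ K → suc (toℕ (combine p q)) ≡ K * suc (toℕ p)
    suc-combine-last p {q} q-last =
      trans (suc-combine p q) (trans (cong (K * toℕ p +_) q-last) (trans (+-comm (K * toℕ p) K) (sym (*-suc K (toℕ p)))))

  consec-combine-inner : ∀ (p : Fin n) {q q′ : Fin K} → suc (toℕ q) ≡ toℕ q′ →
                         Consec (n * K) (combine p q) (combine p q′)
  consec-combine-inner p {q} {q′} q→q′ = inj₁ (begin
    suc (toℕ (combine p q))   ≡⟨ suc-combine p q ⟩
    K * toℕ p + suc (toℕ q)   ≡⟨ cong (K * toℕ p +_) q→q′ ⟩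
    K * toℕ p + toℕ q′        ≡⟨ Finₚ.toℕ-combine p q′ ⟨
    toℕ (combine p q′)        ∎)
    where open ≡-Reasoning

  consec-combine-outer : ∀ {p p′ : Fin n} {q q′ : Fin K} → suc (toℕ q) ≡ K → toℕ q′ ≡ 0 →
                         Consec n p p′ → Consec (n * K) (combine p q) (combine p′ q′)
  consec-combine-outer {p} {p′} {q} {q′} q-last q′-first (inj₁ p+1≡p′) = inj₁ (begin
    suc (toℕ (combine p q))   ≡⟨ suc-combine-last p q-last ⟩
    K * suc (toℕ p)           ≡⟨ cong (K *_) p+1≡p′ ⟩
    K * toℕ p′                ≡⟨ +-identityʳ _ ⟨
    K * toℕ p′ + 0            ≡⟨ cong (K * toℕ p′ +_) q′-first ⟨
    K * toℕ p′ + toℕ q′       ≡⟨ Finₚ.toℕ-combine p′ q′ ⟨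
    toℕ (combine p′ q′)       ∎)
    where open ≡-Reasoning
  consec-combine-outer {p} {p′} {q} {q′} q-last q′-first (inj₂ (p+1≡n , p′≡0)) =
    inj₂ (trans (suc-combine-last p q-last) (trans (cong (K *_) p+1≡n) (*-comm K n)) , (begin
    toℕ (combine p′ q′)   ≡⟨ Finₚ.toℕ-combine p′ q′ ⟩
    K * toℕ p′ + toℕ q′   ≡⟨ cong₂ (λ a b → K * a + b) p′≡0 q′-first ⟩
    K * 0 + 0             ≡⟨ cong (_+ 0) (*-zeroʳ K) ⟩
    0                     ∎))
    where open ≡-Reasoning

  consec-combine⁻ : ∀ {p p′ : Fin n} {q q′ : Fin K} → Consec (n * K) (combine p q) (combine p′ q′) →
                    (p ≡ p′ × suc (toℕ q) ≡ toℕ q′) ⊎ (suc (toℕ q) ≡ K × toℕ q′ ≡ 0 × Consec n p p′)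
  consec-combine⁻ {p} {p′} {q} {q′} c with suc (toℕ q) ℕ.<? K
  ... | yes q+1<K =
    let (p≡p′ , q⁺≡q′) = Finₚ.combine-injective p _ p′ q′
                            (consec-functional (consec-combine-inner p (sym (toℕ-fromℕ< q+1<K))) c)
    in inj₁ (p≡p′ , trans (sym (toℕ-fromℕ< q+1<K)) (cong toℕ q⁺≡q′))
  ... | no q+1≮K =
    let q-last = ≤-antisym (toℕ<n q) (≮⇒≥ q+1≮K)
        first = fromℕ< (≤-<-trans z≤n (toℕ<n q))
        (next≡p′ , first≡q′) = Finₚ.combine-injective (next p) first p′ q′
                                 (consec-functional (consec-combine-outer q-last (toℕ-fromℕ< _) (consec-next p)) c)
    in inj₂ (q-last , trans (sym (cong toℕ first≡q′)) (toℕ-fromℕ< _) , subst (Consec n p) next≡p′ (consec-next p))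

remQuot-injective : ∀ {n K} {ι ι′ : Fin (n * K)} → Fin.remQuot {n} K ι ≡ Fin.remQuot K ι′ → ι ≡ ι′
remQuot-injective {n} {K} {ι} {ι′} e =
  trans (sym (Finₚ.combine-remQuot {n} K ι)) (trans (cong (uncurry combine) e) (Finₚ.combine-remQuot {n} K ι′))

CyclicEdge : ∀ {N m} → (Fin N → Fin m) → Fin m → Fin m → Set
CyclicEdge {N} g u v = ∃[ i ] ∃[ j ] Consec N i j × ((g i ≡ u × g j ≡ v) ⊎ (g i ≡ v × g j ≡ u))

hamCycle-reindex : ∀ {m N} → m ≡ N → (H : Fin m → Fin m → Set) (g : Fin N → Fin m) →
                   3 ≤ N → Injective _≡_ _≡_ g → (∀ u v → H u v ⇔ CyclicEdge g u v) → IsHamCycle m H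
hamCycle-reindex refl H g 3≤N g-inj H⇔ = 3≤N , g , g-inj , H⇔

data Halves : ℕ → Set where
  zero : Halves 0
  one+twice : ∀ s → Halves (suc (s + s))
  two+twice : ∀ s → Halves (suc (suc (s + s)))

halves : ∀ q → Halves q
halves zero = zero
halves (suc q) with halves q
... | zero = one+twice 0
... | one+twice s = two+twice s
... | two+twice s = subst Halves (cong (suc ∘ suc) (+-suc s s)) (one+twice (suc s))

m+m≤n+n⇒m≤n : ∀ {a b} → a + a ≤ b + b → a ≤ b
m+m≤n+n⇒m≤n {a} {b} h with a ≤? b
... | yes a≤b = a≤b
... | no a≰b = ⊥-elim (<⇒≱ (+-mono-< (≰⇒> a≰b) (≰⇒> a≰b)) h)

m+m<n+n⇒m<n : ∀ {a b} → a + a < b + b → a < b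
m+m<n+n⇒m<n {a} {b} h with a <? b
... | yes a<b = a<b
... | no a≮b = ⊥-elim (<⇒≱ h (+-mono-≤ (≮⇒≥ a≮b) (≮⇒≥ a≮b)))

⌊/2⌋-cases : ∀ u → u ≡ ⌊ u /2⌋ + ⌊ u /2⌋ ⊎ u ≡ suc (⌊ u /2⌋ + ⌊ u /2⌋)
⌊/2⌋-cases zero = inj₁ refl
⌊/2⌋-cases (suc zero) = inj₂ refl
⌊/2⌋-cases (suc (suc u)) with ⌊/2⌋-cases u
... | inj₁ e = inj₁ (trans (cong (suc ∘ suc) e) (cong suc (sym (+-suc ⌊ u /2⌋ ⌊ u /2⌋))))
... | inj₂ e = inj₂ (trans (cong (suc ∘ suc) e) (cong (suc ∘ suc) (sym (+-suc ⌊ u /2⌋ ⌊ u /2⌋))))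

⌊/2⌋-< : ∀ {u t} → u < t + t → ⌊ u /2⌋ < t
⌊/2⌋-< {u} u<2t with ⌊/2⌋-cases u
... | inj₁ e = m+m<n+n⇒m<n (subst (_< _) e u<2t)
... | inj₂ e = m+m<n+n⇒m<n (<-trans (n<1+n _) (subst (_< _) e u<2t))

parity-twice : ∀ s → parity (s + s) ≡ 0ℙ
parity-twice zero = refl
parity-twice (suc s) rewrite +-suc s s = parity-twice s

parity-twice+1 : ∀ s → parity (suc (s + s)) ≡ 1ℙ
parity-twice+1 zero = refl
parity-twice+1 (suc s) rewrite +-suc s s = parity-twice+1 s

module _ {d : ℕ} .{{_ : ℕ.NonZero d}} where

  [m+n%d]%d≡[m+n]%d : ∀ a b → (a + b % d) % d ≡ (a + b) % d
  [m+n%d]%d≡[m+n]%d a b = begin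
    (a + b % d) % d              ≡⟨ %-distribˡ-+ a (b % d) d ⟩
    (a % d + b % d % d) % d      ≡⟨ cong (λ z → (a % d + z) % d) (m%n%n≡m%n b d) ⟩
    (a % d + b % d) % d          ≡⟨ %-distribˡ-+ a b d ⟨
    (a + b) % d                  ∎
    where open ≡-Reasoning

  [m%d+n]%d≡[m+n]%d : ∀ a b → (a % d + b) % d ≡ (a + b) % d
  [m%d+n]%d≡[m+n]%d a b =
    trans (cong (_% d) (+-comm (a % d) b)) (trans ([m+n%d]%d≡[m+n]%d b a) (cong (_% d) (+-comm b a)))

  [j+[x+d∸j]%d]%d≡x : ∀ {j x} → j ≤ d → x < d → (j + (x + (d ∸ j)) % d) % d ≡ x
  [j+[x+d∸j]%d]%d≡x {j} {x} j≤d x<d = begin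
    (j + (x + (d ∸ j)) % d) % d  ≡⟨ [m+n%d]%d≡[m+n]%d j (x + (d ∸ j)) ⟩
    (j + (x + (d ∸ j))) % d      ≡⟨ cong (_% d) (trans (+-comm j _) (trans (+-assoc x (d ∸ j) j) (cong (x +_) (m∸n+n≡m j≤d)))) ⟩
    (x + d) % d                  ≡⟨ [m+n]%n≡m%n x d ⟩
    x % d                        ≡⟨ m<n⇒m%n≡m x<d ⟩
    x                            ∎
    where open ≡-Reasoning

  [x+d∸j]%d+[y+d∸j]%d : ∀ {j x y ε} → j ≤ d → ε < d → (x + y) % d ≡ (j + j) + ε →
                          ((x + (d ∸ j)) % d + (y + (d ∸ j)) % d) % d ≡ ε
  [x+d∸j]%d+[y+d∸j]%d {j} {x} {y} {ε} j≤d ε<d e = begin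
    ((x + u) % d + (y + u) % d) % d  ≡⟨ [m%d+n]%d≡[m+n]%d (x + u) _ ⟩
    ((x + u) + (y + u) % d) % d      ≡⟨ [m+n%d]%d≡[m+n]%d (x + u) (y + u) ⟩
    ((x + u) + (y + u)) % d          ≡⟨ cong (_% d) (interchange x u y u) ⟩
    ((x + y) + (u + u)) % d          ≡⟨ [m%d+n]%d≡[m+n]%d (x + y) (u + u) ⟨
    ((x + y) % d + (u + u)) % d      ≡⟨ cong (λ z → (z + (u + u)) % d) e ⟩
    ((j + j + ε) + (u + u)) % d      ≡⟨ cong (_% d) (trans (cong (_+ (u + u)) (+-comm (j + j) ε)) (+-assoc ε (j + j) (u + u))) ⟩
    (ε + ((j + j) + (u + u))) % d    ≡⟨ cong (λ z → (ε + z) % d) (interchange j j u u) ⟩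
    (ε + ((j + u) + (j + u))) % d    ≡⟨ cong (λ z → (ε + (z + z)) % d) (m+[n∸m]≡n j≤d) ⟩
    (ε + (d + d)) % d                ≡⟨ cong (_% d) (sym (+-assoc ε d d)) ⟩
    ((ε + d) + d) % d                ≡⟨ [m+n]%n≡m%n (ε + d) d ⟩
    (ε + d) % d                      ≡⟨ [m+n]%n≡m%n ε d ⟩
    ε % d                            ≡⟨ m<n⇒m%n≡m ε<d ⟩
    ε                                ∎
    where
    open ≡-Reasoning
    u = d ∸ j

  [j+a]%d-injective : ∀ {j a b} → j ≤ d → a < d → b < d → (j + a) % d ≡ (j + b) % d → a ≡ b
  [j+a]%d-injective {j} {a} {b} j≤d a<d b<d e =
    trans (sym (unrotate a a<d)) (trans (cong (λ z → ((d ∸ j) + z) % d) e) (unrotate b b<d))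
    where
    unrotate : ∀ c → c < d → ((d ∸ j) + (j + c) % d) % d ≡ c
    unrotate c c<d = begin
      ((d ∸ j) + (j + c) % d) % d  ≡⟨ [m+n%d]%d≡[m+n]%d (d ∸ j) (j + c) ⟩
      ((d ∸ j) + (j + c)) % d      ≡⟨ cong (_% d) (trans (sym (+-assoc (d ∸ j) j c))
                                                        (trans (cong (_+ c) (m∸n+n≡m j≤d)) (+-comm d c))) ⟩
      (c + d) % d                  ≡⟨ [m+n]%n≡m%n c d ⟩
      c % d                        ≡⟨ m<n⇒m%n≡m c<d ⟩
      c                            ∎
      where open ≡-Reasoning

  <2d⇒≡%⊎≡%+d : ∀ u → u < d + d → u ≡ u % d ⊎ u ≡ u % d + d
  <2d⇒≡%⊎≡%+d u u<2d with u <? d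
  ... | yes u<d = inj₁ (sym (m<n⇒m%n≡m u<d))
  ... | no u≮d = inj₂ (trans u≡ (cong (_+ d) (sym u%d≡)))
    where
    u≡ : u ≡ (u ∸ d) + d
    u≡ = sym (m∸n+n≡m (≮⇒≥ u≮d))
    u%d≡ : u % d ≡ u ∸ d
    u%d≡ = trans (cong (_% d) u≡) (trans ([m+n]%n≡m%n (u ∸ d) d)
             (m<n⇒m%n≡m (+-cancelʳ-< d (u ∸ d) d (subst (_< d + d) u≡ u<2d))))

-- Walecki's decomposition of complete graphs into Hamilton paths

Step : ℕ → (ℕ → ℕ) → ℕ → ℕ → Set
Step K f x y = ∃[ q ] suc q < K × ((f q ≡ x × f (suc q) ≡ y) ⊎ (f q ≡ y × f (suc q) ≡ x))

step-sym : ∀ {K f x y} → Step K f x y → Step K f y x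
step-sym (q , q+1<K , inj₁ p) = q , q+1<K , inj₂ p
step-sym (q , q+1<K , inj₂ p) = q , q+1<K , inj₁ p

PathEdge : ∀ {K m} → (Fin K → Fin m) → Fin m → Fin m → Set
PathEdge g u v = ∃[ q ] ∃[ q′ ] suc (toℕ q) ≡ toℕ q′ × ((g q ≡ u × g q′ ≡ v) ⊎ (g q ≡ v × g q′ ≡ u))

record PathDecomposition (t K : ℕ) : Set where
  field
    pathOf : Fin K → Fin K → Maybe (Fin t)
    pathOf-sym : ∀ x y → pathOf x y ≡ pathOf y x
    path : Fin t → Fin K → Fin K
    path-injective : ∀ j → Injective _≡_ _≡_ (path j)
    path-start : ∀ j q → toℕ q ≡ 0 → toℕ (path j q) ≡ toℕ j
    path-end : ∀ j q → suc (toℕ q) ≡ K → toℕ (path j q) ≡ t + toℕ j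
    pathOf-path : ∀ j {q q′} → suc (toℕ q) ≡ toℕ q′ → pathOf (path j q) (path j q′) ≡ just j
    path-pathOf : ∀ {x y j} → x ≢ y → pathOf x y ≡ just j → PathEdge (path j) x y

module _ {t K : ℕ} (D : PathDecomposition t K) where
  open PathDecomposition D

  CoversAllEdges : Set
  CoversAllEdges = ∀ x y → x ≢ y → pathOf x y ≢ nothing

  LeavesMatching : Set
  LeavesMatching = Σ (Fin K → Fin K) λ mate →
    (∀ x y → x ≢ y → pathOf x y ≡ nothing → toℕ x < t + t × y ≡ mate x) ×
    (∀ x → toℕ x < t + t → pathOf x (mate x) ≡ nothing × mate x ≢ x)

UnusedEdges : ∀ {t K} → Bool → PathDecomposition t K → Set
UnusedEdges false D = CoversAllEdges D
UnusedEdges true D = LeavesMatching D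

record ℕPathDecomposition (t K : ℕ) : Set where
  field
    pathOf : ℕ → ℕ → Maybe (Fin t)
    pathOf-sym : ∀ {x y} → x < K → y < K → pathOf x y ≡ pathOf y x
    path : ℕ → ℕ → ℕ
    path-< : ∀ j q → path j q < K
    path-injective : ∀ {j q q′} → j < t → q < K → q′ < K → path j q ≡ path j q′ → q ≡ q′
    path-start : ∀ {j} → j < t → path j 0 ≡ j
    path-end : ∀ {j} → j < t → path j (pred K) ≡ t + j
    pathOf-path : ∀ (j : Fin t) {q} → suc q < K → pathOf (path (toℕ j) q) (path (toℕ j) (suc q)) ≡ just j
    path-pathOf : ∀ {x y} (j : Fin t) → x < K → y < K → x ≢ y → pathOf x y ≡ just j → Step K (path (toℕ j)) x y

toPathDecomposition : ∀ {t K} → ℕPathDecomposition t K → PathDecomposition t K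
toPathDecomposition {t} {K} P = record
  { pathOf = λ x y → P.pathOf (toℕ x) (toℕ y)
  ; pathOf-sym = λ x y → P.pathOf-sym (toℕ<n x) (toℕ<n y)
  ; path = path
  ; path-injective = λ j e → toℕ-injective
      (P.path-injective (toℕ<n j) (toℕ<n _) (toℕ<n _) (trans (sym (toℕ-path j _)) (trans (cong toℕ e) (toℕ-path j _))))
  ; path-start = λ j q q≡0 → trans (toℕ-path j q) (trans (cong (P.path (toℕ j)) q≡0) (P.path-start (toℕ<n j)))
  ; path-end = λ j q q+1≡K → trans (toℕ-path j q) (trans (cong (P.path (toℕ j) ∘ pred) q+1≡K) (P.path-end (toℕ<n j)))
  ; pathOf-path = λ j {q} {q′} q+1≡q′ →
      trans (cong₂ P.pathOf (toℕ-path j q) (trans (toℕ-path j q′) (cong (P.path (toℕ j)) (sym q+1≡q′))))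
            (P.pathOf-path j (subst (_< K) (sym q+1≡q′) (toℕ<n q′)))
  ; path-pathOf = λ {x} {y} {j} x≢y e → fromStep j (P.path-pathOf j (toℕ<n x) (toℕ<n y) (x≢y ∘ toℕ-injective) e)
  }
  where
  module P = ℕPathDecomposition P
  path : Fin t → Fin K → Fin K
  path j q = fromℕ< (P.path-< (toℕ j) (toℕ q))
  toℕ-path : ∀ j q → toℕ (path j q) ≡ P.path (toℕ j) (toℕ q)
  toℕ-path j q = toℕ-fromℕ< (P.path-< (toℕ j) (toℕ q))
  fromStep : ∀ {x y} j → Step K (P.path (toℕ j)) (toℕ x) (toℕ y) → PathEdge (path j) x y
  fromStep {x} {y} j (q , q+1<K , hit) = fromℕ< q<K , fromℕ< q+1<K ,
    trans (cong suc (toℕ-fromℕ< q<K)) (sym (toℕ-fromℕ< q+1<K)) ,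
    Data.Sum.map (λ (a , b) → at q<K a , at q+1<K b) (λ (a , b) → at q<K a , at q+1<K b) hit
    where
    q<K = <-trans (n<1+n q) q+1<K
    at : ∀ {p z} (p<K : p < K) → P.path (toℕ j) p ≡ toℕ z → path j (fromℕ< p<K) ≡ z
    at {p} p<K e = toℕ-injective (trans (toℕ-path j _) (trans (cong (P.path (toℕ j)) (toℕ-fromℕ< p<K)) e))

-- Vertices of the complete graph on N = 2t vertices are residues mod N.  walk j visits
-- j, j + 1, j − 1, j + 2, j − 2, …, j + t (mod N); its edges are exactly the xy with
-- x + y ≡ 2j or 2j + 1 (mod N), so the t walks partition the edges and classOf recovers j.
module Zigzag (t₀ : ℕ) where

  t N : ℕ
  t = suc t₀
  N = t + t

  zig : Parity → ℕ → ℕ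
  zig 0ℙ s = suc s
  zig 1ℙ s = N ∸ suc s

  zigzag : ℕ → ℕ
  zigzag zero = 0
  zigzag (suc q) = zig (parity q) ⌊ q /2⌋

  zigzag-one+twice : ∀ s → zigzag (suc (s + s)) ≡ suc s
  zigzag-one+twice s rewrite parity-twice s = cong suc (sym (n≡⌊n+n/2⌋ s))

  zigzag-two+twice : ∀ s → zigzag (suc (suc (s + s))) ≡ N ∸ suc s
  zigzag-two+twice s rewrite parity-twice+1 s = cong (λ h → N ∸ suc h) (sym (n≡⌈n+n/2⌉ s))

  zigzag-three+twice : ∀ s → zigzag (suc (suc (suc (s + s)))) ≡ suc (suc s)
  zigzag-three+twice s = subst (λ q → zigzag (suc q) ≡ suc (suc s)) (cong suc (+-suc s s)) (zigzag-one+twice (suc s))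

  t<N : t < N
  t<N = m<m+n t z<s

  private
    one+twice<N⇒ : ∀ {s} → suc (s + s) < N → s < t
    one+twice<N⇒ h = m+m<n+n⇒m<n (<-trans (n<1+n _) h)

    two+twice<N⇒ : ∀ {s} → suc (suc (s + s)) < N → suc s < t
    two+twice<N⇒ {s} h = m+m<n+n⇒m<n (subst (_< N) (cong suc (sym (+-suc s s))) h)

    three+twice<N⇒ : ∀ {s} → suc (suc (suc (s + s))) < N → suc (suc s) ≤ t
    three+twice<N⇒ {s} h = m+m≤n+n⇒m≤n (subst (_≤ N) (cong (suc ∘ suc) (sym (trans (+-suc s (suc s)) (cong suc (+-suc s s))))) h)

    s<t⇒s≤N : ∀ {s} → s < t → s ≤ N
    s<t⇒s≤N s<t = <⇒≤ (<-trans s<t t<N)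

    N∸-split : ∀ {s} → suc s ≤ t → N ∸ suc s ≡ t + (t ∸ suc s)
    N∸-split h = +-∸-assoc t h

    t<N∸ : ∀ {s} → suc s < t → t < N ∸ suc s
    t<N∸ {s} h rewrite N∸-split (<⇒≤ h) = subst (_< t + (t ∸ suc s)) (+-identityʳ t) (+-monoʳ-< t (m<n⇒0<n∸m h))

  zigzag-< : ∀ {q} → q < N → zigzag q < N
  zigzag-< {q} h with halves q
  ... | zero = z<s
  ... | one+twice s rewrite zigzag-one+twice s = ≤-<-trans (one+twice<N⇒ {s} h) t<N
  ... | two+twice s rewrite zigzag-two+twice s = ∸-monoʳ-< z<s (s<t⇒s≤N (two+twice<N⇒ {s} h))

  private
    zigzag-one+twice-≤ : ∀ {s} → s < t → zigzag (suc (s + s)) ≤ t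
    zigzag-one+twice-≤ {s} h rewrite zigzag-one+twice s = h

    zigzag-two+twice-> : ∀ {s} → suc s < t → t < zigzag (suc (suc (s + s)))
    zigzag-two+twice-> {s} h rewrite zigzag-two+twice s = t<N∸ h

  zigzag-injective : ∀ {q q′} → q < N → q′ < N → zigzag q ≡ zigzag q′ → q ≡ q′
  zigzag-injective {q} {q′} h h′ e with halves q | halves q′
  ... | zero | zero = refl
  ... | zero | one+twice s′ rewrite zigzag-one+twice s′ = ⊥-elim (0≢1+n e)
  ... | zero | two+twice s′ = ⊥-elim (<⇒≢ (<-trans z<s (zigzag-two+twice-> (two+twice<N⇒ {s′} h′))) e)
  ... | one+twice s | zero rewrite zigzag-one+twice s = ⊥-elim (0≢1+n (sym e))
  ... | one+twice s | one+twice s′ rewrite zigzag-one+twice s | zigzag-one+twice s′ =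
    cong (λ s → suc (s + s)) (suc-injective e)
  ... | one+twice s | two+twice s′ =
    ⊥-elim (<⇒≢ (≤-<-trans (zigzag-one+twice-≤ (one+twice<N⇒ {s} h)) (zigzag-two+twice-> (two+twice<N⇒ {s′} h′))) e)
  ... | two+twice s | zero = ⊥-elim (<⇒≢ (<-trans z<s (zigzag-two+twice-> (two+twice<N⇒ {s} h))) (sym e))
  ... | two+twice s | one+twice s′ =
    ⊥-elim (<⇒≢ (≤-<-trans (zigzag-one+twice-≤ (one+twice<N⇒ {s′} h′)) (zigzag-two+twice-> (two+twice<N⇒ {s} h))) (sym e))
  ... | two+twice s | two+twice s′ rewrite zigzag-two+twice s | zigzag-two+twice s′ =
    cong (λ s → suc (suc (s + s)))
      (suc-injective (∸-cancelˡ-≡ (s<t⇒s≤N (two+twice<N⇒ {s} h)) (s<t⇒s≤N (two+twice<N⇒ {s′} h′)) e))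

  -- for distinct a, b < N: a + b ≡ 0 or 1 (mod N)
  AdjacentSum : ℕ → ℕ → Set
  AdjacentSum a b = a + b ≡ 1 ⊎ a + b ≡ N ⊎ a + b ≡ suc N

  adjacentSum-sym : ∀ {a b} → AdjacentSum a b → AdjacentSum b a
  adjacentSum-sym {a} {b} = Data.Sum.map (trans (+-comm b a)) (Data.Sum.map (trans (+-comm b a)) (trans (+-comm b a)))

  zigzag-adjacentSum : ∀ {q} → suc q < N → AdjacentSum (zigzag q) (zigzag (suc q))
  zigzag-adjacentSum {q} h with halves q
  ... | zero = inj₁ refl
  ... | one+twice s rewrite zigzag-one+twice s | zigzag-two+twice s =
    inj₂ (inj₁ (m+[n∸m]≡n (s<t⇒s≤N (two+twice<N⇒ {s} h))))
  ... | two+twice s rewrite zigzag-two+twice s | zigzag-three+twice s =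
    inj₂ (inj₂ (trans (+-suc (N ∸ suc s) (suc s)) (cong suc (m∸n+n≡m (<⇒≤ (<-trans (three+twice<N⇒ {s} h) t<N))))))

  1<N : 1 < N
  1<N = ≤-<-trans (s≤s z≤n) t<N

  private
    twice-suc : ∀ s → suc s + suc s ≡ suc (suc (s + s))
    twice-suc s = cong suc (+-suc s s)

  adjacentSum⇒zigzagStep : ∀ {a b} → a < b → b < N → AdjacentSum a b → Step N zigzag a b
  adjacentSum⇒zigzagStep {zero} a<b b<N (inj₁ e) = 0 , 1<N , inj₁ (refl , sym e)
  adjacentSum⇒zigzagStep {suc a} {b} a<b b<N (inj₁ e) =
    ⊥-elim (<⇒≢ (<-trans z<s a<b) (sym (m+n≡0⇒n≡0 a (suc-injective e))))
  adjacentSum⇒zigzagStep {zero} a<b b<N (inj₂ (inj₁ e)) = ⊥-elim (<-irrefl e b<N)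
  adjacentSum⇒zigzagStep {suc s} {b} a<b b<N (inj₂ (inj₁ e)) =
    suc (s + s) , subst (_< N) (twice-suc s) (subst (suc s + suc s <_) e (+-monoʳ-< (suc s) a<b)) ,
    inj₁ (zigzag-one+twice s , trans (zigzag-two+twice s) (trans (cong (_∸ suc s) (sym e)) (m+n∸m≡n (suc s) b)))
  adjacentSum⇒zigzagStep {zero} a<b b<N (inj₂ (inj₂ e)) = ⊥-elim (<-irrefl e (<-trans b<N (n<1+n N)))
  adjacentSum⇒zigzagStep {suc zero} a<b b<N (inj₂ (inj₂ e)) = ⊥-elim (<-irrefl (suc-injective e) b<N)
  adjacentSum⇒zigzagStep {suc (suc s)} {b} a<b b<N (inj₂ (inj₂ e)) =
    suc (suc (s + s)) ,
    ≤-pred (subst (_≤ suc N) (cong suc (twice-suc₂ s)) (subst (suc (suc s) + suc (suc s) <_) e (+-monoʳ-< (suc (suc s)) a<b))) ,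
    inj₂ (trans (zigzag-two+twice s) (trans (cong (_∸ suc s) (sym (suc-injective e))) (m+n∸m≡n (suc s) b)) ,
          zigzag-three+twice s)
    where
    twice-suc₂ : ∀ s → suc (suc s) + suc (suc s) ≡ suc (suc (suc (suc (s + s))))
    twice-suc₂ s = cong (suc ∘ suc) (trans (+-suc s (suc s)) (cong suc (+-suc s s)))

  private
    %N-small : ∀ {a} → a < N → a % N ≡ a
    %N-small = m<n⇒m%n≡m

    opposite-zigzag-one+twice : ∀ s → suc s < t → (zigzag (suc (s + s)) + t) % N ≡ suc s + t
    opposite-zigzag-one+twice s h rewrite zigzag-one+twice s = %N-small (+-monoˡ-< t h)

    opposite-zigzag-two+twice : ∀ s → suc (suc s) ≤ t → (zigzag (suc (suc (s + s))) + t) % N ≡ t ∸ suc s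
    opposite-zigzag-two+twice s h rewrite zigzag-two+twice s | N∸-split {s} (<⇒≤ h) = begin
      (t + (t ∸ suc s) + t) % N ≡⟨ cong (_% N) (trans (cong (_+ t) (+-comm t (t ∸ suc s))) (+-assoc (t ∸ suc s) t t)) ⟩
      ((t ∸ suc s) + N) % N     ≡⟨ [m+n]%n≡m%n (t ∸ suc s) N ⟩
      (t ∸ suc s) % N           ≡⟨ %N-small (≤-<-trans (m∸n≤m t (suc s)) t<N) ⟩
      t ∸ suc s                 ∎
      where open ≡-Reasoning

    rearrange : ∀ a b → (a + b) + a ≡ b + (a + a)
    rearrange a b = trans (cong (_+ a) (+-comm a b)) (+-assoc b a a)

  zigzag-opposite⇒middle : ∀ {q} → suc q < N → (zigzag q + t) % N ≡ zigzag (suc q) → q ≡ t₀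
  zigzag-opposite⇒middle {q} h e with halves q
  ... | zero = sym (suc-injective (trans (sym (%N-small t<N)) e))
  ... | one+twice s rewrite opposite-zigzag-one+twice s (two+twice<N⇒ {s} h) | zigzag-two+twice s =
    suc-injective (trans (sym (twice-suc s)) 2s+2≡t)
    where
    2s+2≡t : suc s + suc s ≡ t
    2s+2≡t = +-cancelˡ-≡ t _ _ (trans (sym (rearrange (suc s) t))
               (trans (cong (_+ suc s) e) (m∸n+n≡m (s<t⇒s≤N (two+twice<N⇒ {s} h)))))
  ... | two+twice s rewrite opposite-zigzag-two+twice s (three+twice<N⇒ {s} h) | zigzag-three+twice s =
    sym (suc-injective (trans t≡ (cong suc (twice-suc s))))
    where
    t≡ : t ≡ suc (suc s) + suc s
    t≡ = trans (sym (m∸n+n≡m (≤-trans (n≤1+n (suc s)) (three+twice<N⇒ {s} h)))) (cong (_+ suc s) e)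

  middle⇒zigzag-opposite : ∀ {q} → suc q < N → q ≡ t₀ → (zigzag q + t) % N ≡ zigzag (suc q)
  middle⇒zigzag-opposite {q} h e with halves q
  ... | zero = trans (%N-small t<N) (cong suc (sym e))
  ... | one+twice s rewrite opposite-zigzag-one+twice s (two+twice<N⇒ {s} h) | zigzag-two+twice s =
    trans (sym (m+n∸n≡m (suc s + t) (suc s)))
      (cong (_∸ suc s) (trans (rearrange (suc s) t) (cong (t +_) (trans (twice-suc s) (cong suc e)))))
  ... | two+twice s rewrite opposite-zigzag-two+twice s (three+twice<N⇒ {s} h) | zigzag-three+twice s =
    trans (cong (_∸ suc s) (trans (cong suc (sym e)) (cong suc (sym (twice-suc s)))))
      (m+n∸n≡m (suc (suc s)) (suc s))

  walk : ℕ → ℕ → ℕ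
  walk j q = (j + zigzag q) % N

  classOf : ℕ → ℕ → ℕ
  classOf x y = ⌊ ((x + y) % N) /2⌋

  opposite : ℕ → ℕ
  opposite x = (x + t) % N

  walk-< : ∀ j q → walk j q < N
  walk-< j q = m%n<n (j + zigzag q) N

  walk-injective : ∀ {j q q′} → j < t → q < N → q′ < N → walk j q ≡ walk j q′ → q ≡ q′
  walk-injective j<t q<N q′<N e =
    zigzag-injective q<N q′<N ([j+a]%d-injective (s<t⇒s≤N j<t) (zigzag-< q<N) (zigzag-< q′<N) e)

  walk-start : ∀ {j} → j < t → walk j 0 ≡ j
  walk-start {j} j<t = trans (cong (_% N) (+-identityʳ j)) (%N-small (<-trans j<t t<N))

  walk-end : ∀ {j} → j < t → walk j (pred N) ≡ t + j
  walk-end {j} j<t = begin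
    (j + zigzag (pred N)) % N        ≡⟨ cong (λ q → (j + zigzag q) % N) (+-suc t₀ t₀) ⟩
    (j + zigzag (suc (t₀ + t₀))) % N ≡⟨ cong (λ z → (j + z) % N) (zigzag-one+twice t₀) ⟩
    (j + t) % N                      ≡⟨ %N-small (+-monoˡ-< t j<t) ⟩
    j + t                            ≡⟨ +-comm j t ⟩
    t + j                            ∎
    where open ≡-Reasoning

  private
    j<t⇒2j+1<N : ∀ {j} → j < t → suc (j + j) < N
    j<t⇒2j+1<N {j} h = subst (_≤ N) (twice-suc j) (+-mono-≤ h h)

  classOf-sym : ∀ x y → classOf x y ≡ classOf y x
  classOf-sym x y = cong (λ z → ⌊ z % N /2⌋) (+-comm x y)

  classOf-< : ∀ x y → classOf x y < t
  classOf-< x y = ⌊/2⌋-< (m%n<n (x + y) N)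

  -- Consecutive zigzag offsets sum to 0 or 1 modulo N, so each step of walk j has (x + y) % N ∈ {2j, 2j + 1}.
  classOf-walk : ∀ j q → j < t → suc q < N → classOf (walk j q) (walk j (suc q)) ≡ j
  classOf-walk j q j<t q+1<N = Data.Sum.[ halve (sym (n≡⌈n+n/2⌉ j)) , halve (sym (n≡⌊n+n/2⌋ j)) ]
                                     (reduce (zigzag-adjacentSum q+1<N))
    where
    sum-rotate : (walk j q + walk j (suc q)) % N ≡ ((j + j) + (zigzag q + zigzag (suc q))) % N
    sum-rotate = trans ([m%d+n]%d≡[m+n]%d (j + zigzag q) _)
                   (trans ([m+n%d]%d≡[m+n]%d (j + zigzag q) (j + zigzag (suc q)))
                     (cong (_% N) (interchange j (zigzag q) j (zigzag (suc q)))))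
    halve : ∀ {u} → ⌊ u /2⌋ ≡ j → ((j + j) + (zigzag q + zigzag (suc q))) % N ≡ u → classOf (walk j q) (walk j (suc q)) ≡ j
    halve {u} u/2≡j e = trans (cong ⌊_/2⌋ (trans sum-rotate e)) u/2≡j
    2j+1<N = j<t⇒2j+1<N j<t
    reduce : ∀ {s} → s ≡ 1 ⊎ s ≡ N ⊎ s ≡ suc N → ((j + j) + s) % N ≡ suc (j + j) ⊎ ((j + j) + s) % N ≡ j + j
    reduce (inj₁ refl) = inj₁ (trans (cong (_% N) (+-comm (j + j) 1)) (%N-small 2j+1<N))
    reduce (inj₂ (inj₁ refl)) = inj₂ (trans ([m+n]%n≡m%n (j + j) N) (%N-small (<-trans (n<1+n _) 2j+1<N)))
    reduce (inj₂ (inj₂ refl)) =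
      inj₁ (trans (cong (_% N) (+-suc (j + j) N)) (trans ([m+n]%n≡m%n (suc (j + j)) N) (%N-small 2j+1<N)))

  offset : ℕ → ℕ → ℕ
  offset j x = (x + (N ∸ j)) % N

  offset-< : ∀ j x → offset j x < N
  offset-< j x = m%n<n (x + (N ∸ j)) N

  classOf⇒adjacentSum : ∀ {j x y} → j < t → offset j x ≢ offset j y → classOf x y ≡ j →
                        AdjacentSum (offset j x) (offset j y)
  classOf⇒adjacentSum {j} {x} {y} j<t a≢b class≡j = cases sum≡ (<2d⇒≡%⊎≡%+d (a + b) (+-mono-< (offset-< j x) (offset-< j y)))
    where
    a = offset j x
    b = offset j y
    unshift : ∀ {ε} → ε < N → (x + y) % N ≡ (j + j) + ε → (a + b) % N ≡ ε
    unshift {ε} = [x+d∸j]%d+[y+d∸j]%d {d = N} {j} {x} {y} {ε} (s<t⇒s≤N j<t)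
    sum≡ : (x + y) % N ≡ (j + j) + 0 ⊎ (x + y) % N ≡ (j + j) + 1
    sum≡ = Data.Sum.map (λ e → trans e (trans (cong (λ h → h + h) class≡j) (sym (+-identityʳ (j + j)))))
                        (λ e → trans e (trans (cong (λ h → suc (h + h)) class≡j) (+-comm 1 (j + j))))
                        (⌊/2⌋-cases ((x + y) % N))
    cases : (x + y) % N ≡ (j + j) + 0 ⊎ (x + y) % N ≡ (j + j) + 1 → a + b ≡ (a + b) % N ⊎ a + b ≡ (a + b) % N + N →
            AdjacentSum a b
    cases (inj₁ e) (inj₁ a+b≡) = ⊥-elim (a≢b (trans (m+n≡0⇒m≡0 a a+b≡0) (sym (m+n≡0⇒n≡0 a a+b≡0))))
      where
      a+b≡0 : a + b ≡ 0
      a+b≡0 = trans a+b≡ (unshift z<s e)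
    cases (inj₁ e) (inj₂ a+b≡) = inj₂ (inj₁ (trans a+b≡ (cong (_+ N) (unshift z<s e))))
    cases (inj₂ e) (inj₁ a+b≡) = inj₁ (trans a+b≡ (unshift 1<N e))
    cases (inj₂ e) (inj₂ a+b≡) = inj₂ (inj₂ (trans a+b≡ (cong (_+ N) (unshift 1<N e))))

  classOf⇒step : ∀ {j x y} → j < t → x < N → y < N → x ≢ y → classOf x y ≡ j → Step N (walk j) x y
  classOf⇒step {j} {x} {y} j<t x<N y<N x≢y class≡j = lift zigzagStep
    where
    offset-shift : ∀ {z} → z < N → (j + offset j z) % N ≡ z
    offset-shift {z} z<N = [j+[x+d∸j]%d]%d≡x {d = N} {j} {z} (s<t⇒s≤N j<t) z<N
    shift-offset : ∀ {z} q → z < N → zigzag q ≡ offset j z → walk j q ≡ z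
    shift-offset q z<N e = trans (cong (λ w → (j + w) % N) e) (offset-shift z<N)
    a≢b : offset j x ≢ offset j y
    a≢b a≡b = x≢y (trans (sym (offset-shift x<N)) (trans (cong (λ w → (j + w) % N) a≡b) (offset-shift y<N)))
    adjacent : AdjacentSum (offset j x) (offset j y)
    adjacent = classOf⇒adjacentSum {j} {x} {y} j<t a≢b class≡j
    zigzagStep : Step N zigzag (offset j x) (offset j y)
    zigzagStep with <-cmp (offset j x) (offset j y)
    ... | tri< a<b _ _ = adjacentSum⇒zigzagStep a<b (offset-< j y) adjacent
    ... | tri≈ _ a≡b _ = ⊥-elim (a≢b a≡b)
    ... | tri> _ _ b<a = step-sym (adjacentSum⇒zigzagStep b<a (offset-< j x) (adjacentSum-sym {offset j x} {offset j y} adjacent))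
    lift : Step N zigzag (offset j x) (offset j y) → Step N (walk j) x y
    lift (q , q+1<N , inj₁ (za , zb)) = q , q+1<N , inj₁ (shift-offset q x<N za , shift-offset (suc q) y<N zb)
    lift (q , q+1<N , inj₂ (zb , za)) = q , q+1<N , inj₂ (shift-offset q y<N zb , shift-offset (suc q) x<N za)

  opposite-< : ∀ x → opposite x < N
  opposite-< x = m%n<n (x + t) N

  opposite-involutive : ∀ {x} → x < N → opposite (opposite x) ≡ x
  opposite-involutive {x} x<N =
    trans ([m%d+n]%d≡[m+n]%d (x + t) t) (trans (cong (_% N) (+-assoc x t t)) (trans ([m+n]%n≡m%n x N) (%N-small x<N)))

  opposite-irreflexive : ∀ {x} → x < N → opposite x ≢ x
  opposite-irreflexive {x} x<N e with <2d⇒≡%⊎≡%+d (x + t) (+-mono-< x<N t<N)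
  ... | inj₁ x+t≡ = 0≢1+n (sym (+-cancelˡ-≡ x t 0 (trans (trans x+t≡ e) (sym (+-identityʳ x)))))
  ... | inj₂ x+t≡ = <-irrefl (+-cancelˡ-≡ x t N (trans x+t≡ (cong (_+ N) e))) t<N

  private
    opposite-walk : ∀ j q → opposite (walk j q) ≡ (j + (zigzag q + t) % N) % N
    opposite-walk j q = trans ([m%d+n]%d≡[m+n]%d (j + zigzag q) t)
                          (trans (cong (_% N) (+-assoc j (zigzag q) t)) (sym ([m+n%d]%d≡[m+n]%d j (zigzag q + t))))

  walk-opposite⇒middle : ∀ j q → j < t → suc q < N → opposite (walk j q) ≡ walk j (suc q) → q ≡ t₀
  walk-opposite⇒middle j q j<t q+1<N e =
    zigzag-opposite⇒middle q+1<N
      ([j+a]%d-injective (s<t⇒s≤N j<t) (m%n<n (zigzag q + t) N) (zigzag-< q+1<N) (trans (sym (opposite-walk j q)) e))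

  walk-middle-opposite : ∀ j → opposite (walk j t₀) ≡ walk j t
  walk-middle-opposite j = trans (opposite-walk j t₀) (cong (λ z → (j + z) % N) (middle⇒zigzag-opposite t<N refl))

  classOf-fin : ℕ → ℕ → Fin t
  classOf-fin x y = fromℕ< (classOf-< x y)

  classOf-fin⇒classOf : ∀ x y {j : Fin t} → classOf-fin x y ≡ j → classOf x y ≡ toℕ j
  classOf-fin⇒classOf x y e = trans (sym (toℕ-fromℕ< _)) (cong toℕ e)

  classOf⇒classOf-fin : ∀ x y {j : Fin t} → classOf x y ≡ toℕ j → classOf-fin x y ≡ j
  classOf⇒classOf-fin x y e = toℕ-injective (trans (toℕ-fromℕ< _) e)

  classOf-fin-sym : ∀ x y → classOf-fin x y ≡ classOf-fin y x
  classOf-fin-sym x y = Finₚ.fromℕ<-cong _ _ (classOf-sym x y) _ _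

  walkDecomposition : ℕPathDecomposition t N
  walkDecomposition = record
    { pathOf = λ x y → just (classOf-fin x y)
    ; pathOf-sym = λ {x} {y} _ _ → cong just (classOf-fin-sym x y)
    ; path = walk
    ; path-< = walk-<
    ; path-injective = walk-injective
    ; path-start = walk-start
    ; path-end = walk-end
    ; pathOf-path = λ j {q} q+1<N →
        cong just (classOf⇒classOf-fin (walk (toℕ j) q) (walk (toℕ j) (suc q)) (classOf-walk (toℕ j) q (toℕ<n j) q+1<N))
    ; path-pathOf = λ {x} {y} j x<N y<N x≢y e → classOf⇒step (toℕ<n j) x<N y<N x≢y (classOf-fin⇒classOf x y (just-injective e))
    }

module Insertion (K p₀ v : ℕ) (f : ℕ → ℕ) where

  insert : ℕ → ℕ
  insert q with <-cmp q (suc p₀)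
  ... | tri< _ _ _ = f q
  ... | tri≈ _ _ _ = v
  ... | tri> _ _ _ = f (pred q)

  insert-< : ∀ {q} → q < suc p₀ → insert q ≡ f q
  insert-< {q} q<p with <-cmp q (suc p₀)
  ... | tri< _ _ _ = refl
  ... | tri≈ q≮p _ _ = ⊥-elim (q≮p q<p)
  ... | tri> q≮p _ _ = ⊥-elim (q≮p q<p)

  insert-≡ : insert (suc p₀) ≡ v
  insert-≡ with <-cmp (suc p₀) (suc p₀)
  ... | tri< _ p≢p _ = ⊥-elim (p≢p refl)
  ... | tri≈ _ _ _ = refl
  ... | tri> _ p≢p _ = ⊥-elim (p≢p refl)

  insert-> : ∀ {q} → suc p₀ < q → insert q ≡ f (pred q)
  insert-> {q} p<q with <-cmp q (suc p₀)
  ... | tri< _ _ q≯p = ⊥-elim (q≯p p<q)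
  ... | tri≈ _ _ q≯p = ⊥-elim (q≯p p<q)
  ... | tri> _ _ _ = refl

  insert-step : ∀ {q} → p₀ < K → suc q < suc K →
                (∃[ q′ ] suc q′ < K × q′ ≢ p₀ × insert q ≡ f q′ × insert (suc q) ≡ f (suc q′))
              ⊎ (insert q ≡ f p₀ × insert (suc q) ≡ v)
              ⊎ (insert q ≡ v × insert (suc q) ≡ f (suc p₀))
  insert-step {q} p₀<K q+1<K+1 with <-cmp q p₀
  ... | tri< q<p₀ _ _ =
    inj₁ (q , ≤-<-trans q<p₀ p₀<K , <⇒≢ q<p₀ , insert-< (<-trans q<p₀ (n<1+n p₀)) , insert-< (s≤s q<p₀))
  ... | tri≈ _ refl _ = inj₂ (inj₁ (insert-< (n<1+n p₀) , insert-≡))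
  ... | tri> _ _ p₀<q with m≤n⇒m<n∨m≡n p₀<q
  ...   | inj₂ refl = inj₂ (inj₂ (insert-≡ , insert-> (n<1+n (suc p₀))))
  ...   | inj₁ p<q = inj₁ (shifted p<q q+1<K+1)
    where
    shifted : ∀ {q} → suc p₀ < q → suc q < suc K →
              ∃[ q′ ] suc q′ < K × q′ ≢ p₀ × insert q ≡ f q′ × insert (suc q) ≡ f (suc q′)
    shifted {suc q₁} (s≤s p₀<q₁) q+1<K+1 =
      q₁ , ≤-pred q+1<K+1 , >⇒≢ p₀<q₁ , insert-> (s≤s p₀<q₁) , insert-> (s≤s (<-trans p₀<q₁ (n<1+n q₁)))

  insert-bounded : ∀ {B} → (∀ q → f q < B) → v < B → ∀ q → insert q < B
  insert-bounded f<B v<B q with <-cmp q (suc p₀)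
  ... | tri< _ _ _ = f<B q
  ... | tri≈ _ _ _ = v<B
  ... | tri> _ _ _ = f<B (pred q)

  insert-lift : ∀ {q′} → suc q′ < K → q′ ≢ p₀ → Step (suc K) insert (f q′) (f (suc q′))
  insert-lift {q′} q′+1<K q′≢p₀ with <-cmp q′ p₀
  ... | tri< q′<p₀ _ _ = q′ , <-trans q′+1<K (n<1+n K) , inj₁ (insert-< (<-trans q′<p₀ (n<1+n p₀)) , insert-< (s≤s q′<p₀))
  ... | tri≈ _ q′≡p₀ _ = ⊥-elim (q′≢p₀ q′≡p₀)
  ... | tri> _ _ p₀<q′ = suc q′ , s≤s q′+1<K , inj₁ (insert-> (s≤s p₀<q′) , insert-> (s≤s (<-trans p₀<q′ (n<1+n q′))))

  insert-step-before : p₀ < K → Step (suc K) insert (f p₀) v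
  insert-step-before p₀<K = p₀ , s≤s p₀<K , inj₁ (insert-< (n<1+n p₀) , insert-≡)

  insert-step-after : suc p₀ < K → Step (suc K) insert v (f (suc p₀))
  insert-step-after p+1<K = suc p₀ , s≤s p+1<K , inj₁ (insert-≡ , insert-> (n<1+n (suc p₀)))

  insert-injective : p₀ < K → (∀ {q} → q < K → f q ≢ v) → (∀ {q q′} → q < K → q′ < K → f q ≡ f q′ → q ≡ q′) →
                     ∀ {q q′} → q < suc K → q′ < suc K → insert q ≡ insert q′ → q ≡ q′
  insert-injective p₀<K f≢v f-inj {q} {q′} q<K+1 q′<K+1 e = go (<-cmp q (suc p₀)) (<-cmp q′ (suc p₀))
    where
    <K : ∀ {q} → q < suc p₀ → q < K
    <K q<p = <-≤-trans q<p p₀<K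
    pred<K : ∀ {q} → suc p₀ < q → q < suc K → pred q < K
    pred<K {suc q} _ q<K+1 = ≤-pred q<K+1
    p≤pred : ∀ {q} → suc p₀ < q → suc p₀ ≤ pred q
    p≤pred {suc q} p<q = ≤-pred p<q
    go : Tri (q < suc p₀) (q ≡ suc p₀) (suc p₀ < q) → Tri (q′ < suc p₀) (q′ ≡ suc p₀) (suc p₀ < q′) → q ≡ q′
    go (tri< a _ _) (tri< b _ _) = f-inj (<K a) (<K b) (trans (sym (insert-< a)) (trans e (insert-< b)))
    go (tri< a _ _) (tri≈ _ refl _) = ⊥-elim (f≢v (<K a) (trans (sym (insert-< a)) (trans e insert-≡)))
    go (tri< a _ _) (tri> _ _ b) =
      ⊥-elim (<⇒≢ (<-≤-trans a (p≤pred b)) (f-inj (<K a) (pred<K b q′<K+1) (trans (sym (insert-< a)) (trans e (insert-> b)))))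
    go (tri≈ _ refl _) (tri< b _ _) = ⊥-elim (f≢v (<K b) (trans (sym (insert-< b)) (trans (sym e) insert-≡)))
    go (tri≈ _ a _) (tri≈ _ b _) = trans a (sym b)
    go (tri≈ _ refl _) (tri> _ _ b) = ⊥-elim (f≢v (pred<K b q′<K+1) (trans (sym (insert-> b)) (trans (sym e) insert-≡)))
    go (tri> _ _ a) (tri< b _ _) =
      ⊥-elim (<⇒≢ (<-≤-trans b (p≤pred a)) (f-inj (<K b) (pred<K a q<K+1) (trans (sym (insert-< b)) (trans (sym e) (insert-> a)))))
    go (tri> _ _ a) (tri≈ _ refl _) = ⊥-elim (f≢v (pred<K a q<K+1) (trans (sym (insert-> a)) (trans e insert-≡)))
    go (tri> _ _ a) (tri> _ _ b) = pred-injective {{ℕ.>-nonZero (<-trans z<s a)}} {{ℕ.>-nonZero (<-trans z<s b)}}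
                                     (f-inj (pred<K a q<K+1) (pred<K b q′<K+1) (trans (sym (insert-> a)) (trans e (insert-> b))))

-- For N + 1 vertices the extra vertex ∞ = N is inserted into every walk between its middle
-- vertices walk j t₀ and walk j t, which are opposite (x and x + t).  The edges between opposite
-- points are left over and form a perfect matching; an edge from ∞ to x inherits the class of the
-- diameter through x.
module ApexExtension (t₀ : ℕ) where
  open Zigzag t₀

  ∞ K : ℕ
  ∞ = N
  K = suc N

  pathOf₁ : ℕ → ℕ → Maybe (Fin t)
  pathOf₁ x y with x ≟ ∞ | y ≟ ∞ | opposite x ≟ y
  ... | yes _ | _ | _ = just (classOf-fin y (opposite y))
  ... | no _ | yes _ | _ = just (classOf-fin x (opposite x))
  ... | no _ | no _ | yes _ = nothing
  ... | no _ | no _ | no _ = just (classOf-fin x y)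

  data PathOf₁ (x y : ℕ) : Maybe (Fin t) → Set where
    apexˡ : x ≡ ∞ → PathOf₁ x y (just (classOf-fin y (opposite y)))
    apexʳ : x ≢ ∞ → y ≡ ∞ → PathOf₁ x y (just (classOf-fin x (opposite x)))
    diameter : x ≢ ∞ → y ≢ ∞ → opposite x ≡ y → PathOf₁ x y nothing
    chord : x ≢ ∞ → y ≢ ∞ → opposite x ≢ y → PathOf₁ x y (just (classOf-fin x y))

  pathOf₁-view : ∀ x y → PathOf₁ x y (pathOf₁ x y)
  pathOf₁-view x y with x ≟ ∞ | y ≟ ∞ | opposite x ≟ y
  ... | yes x≡∞ | _ | _ = apexˡ x≡∞
  ... | no x≢∞ | yes y≡∞ | _ = apexʳ x≢∞ y≡∞
  ... | no x≢∞ | no y≢∞ | yes opp = diameter x≢∞ y≢∞ opp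
  ... | no x≢∞ | no y≢∞ | no ¬opp = chord x≢∞ y≢∞ ¬opp

  pathOf₁-apexˡ : ∀ y → pathOf₁ ∞ y ≡ just (classOf-fin y (opposite y))
  pathOf₁-apexˡ y with ∞ ≟ ∞
  ... | yes _ = refl
  ... | no ∞≢∞ = ⊥-elim (∞≢∞ refl)

  pathOf₁-apexʳ : ∀ {x} → x < ∞ → pathOf₁ x ∞ ≡ just (classOf-fin x (opposite x))
  pathOf₁-apexʳ {x} x<∞ with x ≟ ∞ | ∞ ≟ ∞
  ... | yes x≡∞ | _ = ⊥-elim (<-irrefl x≡∞ x<∞)
  ... | no _ | yes _ = refl
  ... | no _ | no ∞≢∞ = ⊥-elim (∞≢∞ refl)

  pathOf₁-diameter : ∀ {x} → x < ∞ → pathOf₁ x (opposite x) ≡ nothing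
  pathOf₁-diameter {x} x<∞ with x ≟ ∞ | opposite x ≟ ∞ | opposite x ≟ opposite x
  ... | yes x≡∞ | _ | _ = ⊥-elim (<-irrefl x≡∞ x<∞)
  ... | no _ | yes opp≡∞ | _ = ⊥-elim (<-irrefl opp≡∞ (opposite-< x))
  ... | no _ | no _ | yes _ = refl
  ... | no _ | no _ | no opp≢opp = ⊥-elim (opp≢opp refl)

  pathOf₁-chord : ∀ {x y} → x < ∞ → y < ∞ → opposite x ≢ y → pathOf₁ x y ≡ just (classOf-fin x y)
  pathOf₁-chord {x} {y} x<∞ y<∞ ¬opp with x ≟ ∞ | y ≟ ∞ | opposite x ≟ y
  ... | yes x≡∞ | _ | _ = ⊥-elim (<-irrefl x≡∞ x<∞)
  ... | no _ | yes y≡∞ | _ = ⊥-elim (<-irrefl y≡∞ y<∞)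
  ... | no _ | no _ | yes opp = ⊥-elim (¬opp opp)
  ... | no _ | no _ | no _ = refl

  pathOf₁-sym : ∀ {x y} → x < K → y < K → pathOf₁ x y ≡ pathOf₁ y x
  pathOf₁-sym {x} {y} x≤∞ y≤∞ with m≤n⇒m<n∨m≡n (≤-pred x≤∞) | m≤n⇒m<n∨m≡n (≤-pred y≤∞)
  ... | inj₂ refl | inj₂ refl = refl
  ... | inj₂ refl | inj₁ y<∞ = trans (pathOf₁-apexˡ y) (sym (pathOf₁-apexʳ y<∞))
  ... | inj₁ x<∞ | inj₂ refl = trans (pathOf₁-apexʳ x<∞) (sym (pathOf₁-apexˡ x))
  ... | inj₁ x<∞ | inj₁ y<∞ = finite (opposite x ≟ y)
    where
    finite : Dec (opposite x ≡ y) → pathOf₁ x y ≡ pathOf₁ y x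
    finite (yes opp) = trans (subst (λ z → pathOf₁ x z ≡ nothing) opp (pathOf₁-diameter x<∞))
      (sym (subst₂ (λ u z → pathOf₁ u z ≡ nothing) opp (opposite-involutive x<∞) (pathOf₁-diameter (opposite-< x))))
    finite (no ¬opp) = trans (pathOf₁-chord x<∞ y<∞ ¬opp)
                         (trans (cong just (classOf-fin-sym x y)) (sym (pathOf₁-chord y<∞ x<∞ ¬opp′)))
      where
      ¬opp′ : opposite y ≢ x
      ¬opp′ e = ¬opp (trans (cong opposite (sym e)) (opposite-involutive y<∞))

  module Path (j : ℕ) = Insertion N t₀ ∞ (walk j)

  path₁ : ℕ → ℕ → ℕ
  path₁ j = Path.insert j

  t₀<N : t₀ < N
  t₀<N = <-trans (n<1+n t₀) t<N

  walk-opposite-middle : ∀ j → opposite (walk j t) ≡ walk j t₀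
  walk-opposite-middle j = trans (cong opposite (sym (walk-middle-opposite j))) (opposite-involutive (walk-< j t₀))

  pathOf₁-path₁ : ∀ (j : Fin t) {q} → suc q < K → pathOf₁ (path₁ (toℕ j) q) (path₁ (toℕ j) (suc q)) ≡ just j
  pathOf₁-path₁ j {q} q+1<K with Path.insert-step (toℕ j) t₀<N q+1<K
  ... | inj₁ (q′ , q′+1<N , q′≢t₀ , e₁ , e₂) rewrite e₁ | e₂ =
    trans (pathOf₁-chord {walk (toℕ j) q′} {walk (toℕ j) (suc q′)} (walk-< (toℕ j) q′) (walk-< (toℕ j) (suc q′))
                         (q′≢t₀ ∘ walk-opposite⇒middle (toℕ j) q′ (toℕ<n j) q′+1<N))
          (cong just (classOf⇒classOf-fin (walk (toℕ j) q′) (walk (toℕ j) (suc q′)) (classOf-walk (toℕ j) q′ (toℕ<n j) q′+1<N)))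
  ... | inj₂ (inj₁ (e₁ , e₂)) rewrite e₁ | e₂ =
    trans (pathOf₁-apexʳ {w₀} (walk-< (toℕ j) t₀))
          (cong just (classOf⇒classOf-fin w₀ (opposite w₀)
                       (trans (cong (classOf w₀) (walk-middle-opposite (toℕ j))) (classOf-walk (toℕ j) t₀ (toℕ<n j) t<N))))
    where w₀ = walk (toℕ j) t₀
  ... | inj₂ (inj₂ (e₁ , e₂)) rewrite e₁ | e₂ =
    trans (pathOf₁-apexˡ w)
          (cong just (classOf⇒classOf-fin w (opposite w) (trans (cong (classOf w) (walk-opposite-middle (toℕ j)))
                       (trans (classOf-sym w (walk (toℕ j) t₀)) (classOf-walk (toℕ j) t₀ (toℕ<n j) t<N)))))
    where w = walk (toℕ j) t

  path₁-step-apex : ∀ j {y} → j < t → y < ∞ → classOf y (opposite y) ≡ j → Step K (path₁ j) ∞ y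
  path₁-step-apex j {y} j<t y<∞ class≡j
    with classOf⇒step j<t y<∞ (opposite-< y) (λ e → opposite-irreflexive y<∞ (sym e)) class≡j
  ... | q , q+1<N , inj₁ (wq≡y , wq+1≡opp) =
    step-sym (subst (λ z → Step K (path₁ j) z ∞) (trans (cong (walk j) (sym q≡t₀)) wq≡y) (Path.insert-step-before j t₀<N))
    where
    q≡t₀ : q ≡ t₀
    q≡t₀ = walk-opposite⇒middle j q j<t q+1<N (trans (cong opposite wq≡y) (sym wq+1≡opp))
  ... | q , q+1<N , inj₂ (wq≡opp , wq+1≡y) =
    subst (Step K (path₁ j) ∞) (trans (cong (walk j ∘ suc) (sym q≡t₀)) wq+1≡y) (Path.insert-step-after j t<N)
    where
    q≡t₀ : q ≡ t₀
    q≡t₀ = walk-opposite⇒middle j q j<t q+1<N (trans (cong opposite wq≡opp) (trans (opposite-involutive y<∞) (sym wq+1≡y)))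

  private
    middle-opposite-step : ∀ j {q x y} → q ≡ t₀ → walk j q ≡ x → walk j (suc q) ≡ y → opposite x ≡ y
    middle-opposite-step j refl wq≡x wq+1≡y = trans (cong opposite (sym wq≡x)) (trans (walk-middle-opposite j) wq+1≡y)

    middle-opposite-step′ : ∀ j {q x y} → q ≡ t₀ → walk j q ≡ y → walk j (suc q) ≡ x → opposite x ≡ y
    middle-opposite-step′ j refl wq≡y wq+1≡x = trans (cong opposite (sym wq+1≡x)) (trans (walk-opposite-middle j) wq≡y)

  path₁-step-chord : ∀ j {x y} → j < t → x < ∞ → y < ∞ → x ≢ y → opposite x ≢ y → classOf x y ≡ j →
                     Step K (path₁ j) x y
  path₁-step-chord j {x} {y} j<t x<∞ y<∞ x≢y ¬opp class≡j with classOf⇒step j<t x<∞ y<∞ x≢y class≡j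
  ... | q , q+1<N , inj₁ (wq≡x , wq+1≡y) =
    subst₂ (Step K (path₁ j)) wq≡x wq+1≡y
      (Path.insert-lift j q+1<N (λ q≡t₀ → ¬opp (middle-opposite-step j q≡t₀ wq≡x wq+1≡y)))
  ... | q , q+1<N , inj₂ (wq≡y , wq+1≡x) =
    step-sym (subst₂ (Step K (path₁ j)) wq≡y wq+1≡x
      (Path.insert-lift j q+1<N (λ q≡t₀ → ¬opp (middle-opposite-step′ j q≡t₀ wq≡y wq+1≡x))))

  <∞ : ∀ {x} → x < K → x ≢ ∞ → x < ∞
  <∞ x<K = ≤∧≢⇒< (≤-pred x<K)

  path₁-pathOf₁ : ∀ {x y} (j : Fin t) → x < K → y < K → x ≢ y → pathOf₁ x y ≡ just j → Step K (path₁ (toℕ j)) x y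
  path₁-pathOf₁ {x} {y} j x<K y<K x≢y e with pathOf₁ x y | pathOf₁-view x y
  ... | _ | apexˡ refl =
    path₁-step-apex (toℕ j) (toℕ<n j) (<∞ y<K (x≢y ∘ sym)) (classOf-fin⇒classOf y (opposite y) (just-injective e))
  ... | _ | apexʳ x≢∞ refl =
    step-sym (path₁-step-apex (toℕ j) (toℕ<n j) (<∞ x<K x≢∞) (classOf-fin⇒classOf x (opposite x) (just-injective e)))
  ... | _ | chord x≢∞ y≢∞ ¬opp =
    path₁-step-chord (toℕ j) (toℕ<n j) (<∞ x<K x≢∞) (<∞ y<K y≢∞) x≢y ¬opp (classOf-fin⇒classOf x y (just-injective e))
  ... | _ | diameter _ _ _ = ⊥-elim (just≢nothing (sym e))

  apexDecomposition : ℕPathDecomposition t K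
  apexDecomposition = record
    { pathOf = pathOf₁
    ; pathOf-sym = pathOf₁-sym
    ; path = path₁
    ; path-< = λ j → Path.insert-bounded j (λ q → <-trans (walk-< j q) (n<1+n N)) (n<1+n N)
    ; path-injective = λ {j} j<t → Path.insert-injective j t₀<N (λ {q} _ e → <-irrefl e (walk-< j q)) (walk-injective j<t)
    ; path-start = λ {j} j<t → trans (Path.insert-< j z<s) (walk-start j<t)
    ; path-end = λ {j} j<t → trans (Path.insert-> j t<N) (walk-end j<t)
    ; pathOf-path = pathOf₁-path₁
    ; path-pathOf = path₁-pathOf₁
    }

  apexDecomposition-leavesMatching : LeavesMatching (toPathDecomposition apexDecomposition)
  apexDecomposition-leavesMatching = mate , unused⇒mate , mate-unused
    where
    mate : Fin K → Fin K
    mate x = fromℕ< (<-trans (opposite-< (toℕ x)) (n<1+n N))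
    unused⇒mate : ∀ x y → x ≢ y → pathOf₁ (toℕ x) (toℕ y) ≡ nothing → toℕ x < N × y ≡ mate x
    unused⇒mate x y x≢y e with pathOf₁ (toℕ x) (toℕ y) | pathOf₁-view (toℕ x) (toℕ y)
    ... | _ | diameter x≢∞ _ opp = <∞ (toℕ<n x) x≢∞ , toℕ-injective (trans (sym opp) (sym (toℕ-fromℕ< _)))
    ... | _ | apexˡ _ = ⊥-elim (just≢nothing e)
    ... | _ | apexʳ _ _ = ⊥-elim (just≢nothing e)
    ... | _ | chord _ _ _ = ⊥-elim (just≢nothing e)
    mate-unused : ∀ x → toℕ x < N → pathOf₁ (toℕ x) (toℕ (mate x)) ≡ nothing × mate x ≢ x
    mate-unused x x<N = trans (cong (pathOf₁ (toℕ x)) (toℕ-fromℕ< _)) (pathOf₁-diameter x<N) ,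
                        λ e → opposite-irreflexive x<N (trans (sym (toℕ-fromℕ< _)) (cong toℕ e))

bit : Bool → ℕ
bit false = 0
bit true = 1

trivialDecomposition : ∀ K → PathDecomposition 0 K
trivialDecomposition K = record
  { pathOf = λ _ _ → nothing
  ; pathOf-sym = λ _ _ → refl
  ; path = λ ()
  ; path-injective = λ ()
  ; path-start = λ ()
  ; path-end = λ ()
  ; pathOf-path = λ ()
  ; path-pathOf = λ _ ()
  }

walecki : ∀ t e → Σ (PathDecomposition t ((t + t) + bit e)) (UnusedEdges e)
walecki zero false = trivialDecomposition 0 , λ ()
walecki zero true = trivialDecomposition 1 , (λ x → x) , (λ { Fin.zero Fin.zero 0≢0 _ → ⊥-elim (0≢0 refl) }) , (λ _ ())
walecki (suc t₀) false =
  subst (λ K → Σ (PathDecomposition (suc t₀) K) (UnusedEdges false)) (sym (+-identityʳ _))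
    (toPathDecomposition walkDecomposition , λ _ _ _ ())
  where open Zigzag t₀
walecki (suc t₀) true =
  subst (λ K → Σ (PathDecomposition (suc t₀) K) (UnusedEdges true)) (+-comm 1 _)
    (toPathDecomposition apexDecomposition , apexDecomposition-leavesMatching)
  where open ApexExtension t₀

-- The complete generalized truncation

-- the class nothing of a Hamilton decomposition of even (false) or odd (true) valency
Leftover : ∀ {n} → Bool → (Fin n → Fin n → Set) → Set
Leftover false Cl = ∀ u v → ¬ Cl u v
Leftover {n} true Cl = IsPerfectMatching n Cl

leftover-matching : ∀ {n} {Cl : Fin n → Fin n → Set} e → Leftover e Cl → Fin (bit e) → IsPerfectMatching n Cl
leftover-matching true pm _ = pm

leftover-edge : ∀ {n} {Cl : Fin n → Fin n → Set} e → Leftover e Cl → ∀ {u v} → Cl u v → Fin (bit e)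
leftover-edge false none {u} {v} c = ⊥-elim (none u v c)
leftover-edge true _ _ = Fin.zero

bit-irrelevant : ∀ e (x y : Fin (bit e)) → x ≡ y
bit-irrelevant true Fin.zero Fin.zero = refl

module Truncation {n m k : ℕ} (X : Adj n) (loopless : ∀ u → X u u ≡ false) (HD : HamDecomposition X k)
                  (e : Bool) (leftover : Leftover e (HamDecomposition.Class HD nothing)) (T : GenTruncData X m) where

  open HamDecomposition HD
  open GenTruncData T

  colour-cong : ∀ {u u′ v v′} (p : X u v ≡ true) (p′ : X u′ v′ ≡ true) → u ≡ u′ → v ≡ v′ →
                colour u v p ≡ colour u′ v′ p′
  colour-cong p p′ refl refl = cong (colour _ _) (≡true-irrelevant p p′)

  order : Fin r → Fin n → Fin n
  order i = proj₁ (proj₂ (cycles i))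

  order-injective : ∀ i → Injective _≡_ _≡_ (order i)
  order-injective i = proj₁ (proj₂ (proj₂ (cycles i)))

  class⇒cyclicEdge : ∀ i {u v} → Class (just i) u v → CyclicEdge (order i) u v
  class⇒cyclicEdge i {u} {v} = Equivalence.to (proj₂ (proj₂ (proj₂ (cycles i))) u v)

  cyclicEdge⇒class : ∀ i {u v} → CyclicEdge (order i) u v → Class (just i) u v
  cyclicEdge⇒class i {u} {v} = Equivalence.from (proj₂ (proj₂ (proj₂ (cycles i))) u v)

  position : Fin r → Fin n → Fin n
  position i v = proj₁ (injective⇒surjective (order i) (order-injective i) v)

  order-position : ∀ i v → order i (position i v) ≡ v
  order-position i v = proj₂ (injective⇒surjective (order i) (order-injective i) v)

  position-order : ∀ i {a v} → order i a ≡ v → a ≡ position i v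
  position-order i {a} {v} e = order-injective i (trans e (sym (order-position i v)))

  -- The neighbours of a vertex v of X: its predecessor and successor on each Hamilton cycle, and (for odd
  -- valency) its partner in the perfect matching.
  Slot : Set
  Slot = (Fin r ⊎ Fin r) ⊎ Fin (bit e)

  pattern before i = inj₁ (inj₁ i)
  pattern after i = inj₁ (inj₂ i)
  pattern matched x = inj₂ x

  slotColour : Slot → Maybe (Fin r)
  slotColour (before i) = just i
  slotColour (after i) = just i
  slotColour (matched _) = nothing

  neighbour : Fin n → Slot → Fin n
  neighbour v (before i) = order i (prev (position i v))
  neighbour v (after i) = order i (next (position i v))
  neighbour v (matched x) = proj₁ (leftover-matching e leftover x v)

  neighbour-class : ∀ v σ → Class (slotColour σ) v (neighbour v σ)
  neighbour-class v (before i) =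
    cyclicEdge⇒class i (prev (position i v) , position i v , consec-prev _ , inj₂ (refl , order-position i v))
  neighbour-class v (after i) =
    cyclicEdge⇒class i (position i v , next (position i v) , consec-next _ , inj₁ (order-position i v , refl))
  neighbour-class v (matched x) = proj₁ (proj₂ (leftover-matching e leftover x v))

  neighbour-adjacent : ∀ v σ → X v (neighbour v σ) ≡ true
  neighbour-adjacent v σ = proj₁ (neighbour-class v σ)

  neighbour-colour : ∀ v σ → colour v (neighbour v σ) (neighbour-adjacent v σ) ≡ slotColour σ
  neighbour-colour v σ = proj₂ (neighbour-class v σ)

  neighbour-after : ∀ i {a b} → Consec n a b → neighbour (order i a) (after i) ≡ order i b
  neighbour-after i a→b = trans (cong (order i ∘ next) (sym (position-order i refl))) (cong (order i) (sym (consec⇒≡next a→b)))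

  neighbour-before : ∀ i {a b} → Consec n a b → neighbour (order i b) (before i) ≡ order i a
  neighbour-before i a→b = trans (cong (order i ∘ prev) (sym (position-order i refl))) (cong (order i) (sym (consec⇒≡prev a→b)))

  neighbour-injective : ∀ v {σ σ′} → neighbour v σ ≡ neighbour v σ′ → σ ≡ σ′
  neighbour-injective v {σ} {σ′} eq = go σ σ′ eq
                                         (trans (sym (neighbour-colour v σ)) (trans (colour-cong _ _ refl eq) (neighbour-colour v σ′)))
    where
    prev≢next′ : ∀ i → order i (prev (position i v)) ≢ order i (next (position i v))
    prev≢next′ i e = prev≢next (position i v) (proj₁ (cycles i)) (order-injective i e)
    go : ∀ σ σ′ → neighbour v σ ≡ neighbour v σ′ → slotColour σ ≡ slotColour σ′ → σ ≡ σ′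
    go (before i) (before i′) _ c = cong before (just-injective c)
    go (before i) (after i′) eq c with just-injective c
    ... | refl = ⊥-elim (prev≢next′ i eq)
    go (after i) (before i′) eq c with just-injective c
    ... | refl = ⊥-elim (prev≢next′ i (sym eq))
    go (after i) (after i′) _ c = cong after (just-injective c)
    go (matched x) (matched x′) _ _ = cong matched (bit-irrelevant e x x′)
    go (before _) (matched _) _ c = ⊥-elim (just≢nothing c)
    go (after _) (matched _) _ c = ⊥-elim (just≢nothing c)
    go (matched _) (before _) _ c = ⊥-elim (just≢nothing (sym c))
    go (matched _) (after _) _ c = ⊥-elim (just≢nothing (sym c))

  neighbour-surjective : ∀ v w → X v w ≡ true → Σ Slot λ σ → neighbour v σ ≡ w
  neighbour-surjective v w p = fromClass (colour v w p) (p , refl)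
    where
    fromClass : ∀ c → Class c v w → Σ Slot λ σ → neighbour v σ ≡ w
    fromClass (just i) vw with class⇒cyclicEdge i vw
    ... | a , b , a→b , inj₁ (fa≡v , fb≡w) =
      after i , trans (cong (λ u → neighbour u (after i)) (sym fa≡v)) (trans (neighbour-after i a→b) fb≡w)
    ... | a , b , a→b , inj₂ (fa≡w , fb≡v) =
      before i , trans (cong (λ u → neighbour u (before i)) (sym fb≡v)) (trans (neighbour-before i a→b) fa≡w)
    fromClass nothing vw = matched x , sym (proj₂ (proj₂ (leftover-matching e leftover x v)) w vw)
      where x = leftover-edge e leftover vw

  K : ℕ
  K = (r + r) + bit e

  slotIndex : Slot → Fin K
  slotIndex = Fin.join (r + r) (bit e) ∘ Data.Sum.map₁ (Fin.join r r)

  indexSlot : Fin K → Slot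
  indexSlot = Data.Sum.map₁ (Fin.splitAt r) ∘ Fin.splitAt (r + r)

  indexSlot-slotIndex : ∀ σ → indexSlot (slotIndex σ) ≡ σ
  indexSlot-slotIndex (inj₁ y) rewrite Finₚ.splitAt-join (r + r) (bit e) (inj₁ (Fin.join r r y)) =
    cong inj₁ (Finₚ.splitAt-join r r y)
  indexSlot-slotIndex (inj₂ x) rewrite Finₚ.splitAt-join (r + r) (bit e) (inj₂ {A = Fin (r + r)} x) = refl

  slotIndex-indexSlot : ∀ s → slotIndex (indexSlot s) ≡ s
  slotIndex-indexSlot s = trans (cong (Fin.join (r + r) (bit e)) (join-split (Fin.splitAt (r + r) s))) (Finₚ.join-splitAt (r + r) (bit e) s)
    where
    join-split : ∀ (u : Fin (r + r) ⊎ Fin (bit e)) → Data.Sum.map₁ (Fin.join r r) (Data.Sum.map₁ (Fin.splitAt r) u) ≡ u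
    join-split (inj₁ y) = cong inj₁ (Finₚ.join-splitAt r r y)
    join-split (inj₂ x) = refl

  toℕ-slotIndex-before : ∀ i → toℕ (slotIndex (before i)) ≡ toℕ i
  toℕ-slotIndex-before i = trans (Finₚ.toℕ-↑ˡ _ (bit e)) (Finₚ.toℕ-↑ˡ i r)

  toℕ-slotIndex-after : ∀ i → toℕ (slotIndex (after i)) ≡ r + toℕ i
  toℕ-slotIndex-after i = trans (Finₚ.toℕ-↑ˡ _ (bit e)) (Finₚ.toℕ-↑ʳ r i)

  slotIndex-<⇒colour : ∀ σ → toℕ (slotIndex σ) < r + r → ∃[ i ] slotColour σ ≡ just i
  slotIndex-<⇒colour (before i) _ = i , refl
  slotIndex-<⇒colour (after i) _ = i , refl
  slotIndex-<⇒colour (matched x) h = ⊥-elim (m+n≮m (r + r) _ (subst (_< r + r) (Finₚ.toℕ-↑ʳ (r + r) x) h))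

  colour⇒slotIndex-< : ∀ {σ i} → slotColour σ ≡ just i → toℕ (slotIndex σ) < r + r
  colour⇒slotIndex-< {inj₁ y} _ = subst (_< r + r) (sym (Finₚ.toℕ-↑ˡ _ (bit e))) (toℕ<n (Fin.join r r y))
  colour⇒slotIndex-< {matched _} c = ⊥-elim (just≢nothing (sym c))

  -- clusterVertex v s: the vertex of cl(v) whose M₀-edge leads to the neighbour of v in slot s
  clusterVertex : Fin n → Fin K → Fin m
  clusterVertex v s = proj₁ (partner-unique v (neighbour v (indexSlot s)) (neighbour-adjacent v (indexSlot s)))

  lab-clusterVertex : ∀ v s → lab (clusterVertex v s) ≡ v
  lab-clusterVertex v s = proj₁ (proj₁ (proj₂ (partner-unique v (neighbour v (indexSlot s)) (neighbour-adjacent v (indexSlot s)))))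

  lab-partner-clusterVertex : ∀ v s → lab (partner (clusterVertex v s)) ≡ neighbour v (indexSlot s)
  lab-partner-clusterVertex v s = proj₂ (proj₁ (proj₂ (partner-unique v (neighbour v (indexSlot s)) (neighbour-adjacent v (indexSlot s)))))

  clusterVertex-unique : ∀ {v s z} → lab z ≡ v → lab (partner z) ≡ neighbour v (indexSlot s) → z ≡ clusterVertex v s
  clusterVertex-unique {v} {s} {z} = proj₂ (proj₂ (partner-unique v (neighbour v (indexSlot s)) (neighbour-adjacent v (indexSlot s)))) z

  slotOf : Fin m → Slot
  slotOf y = proj₁ (neighbour-surjective (lab y) (lab (partner y)) (partner-edge y))

  neighbour-slotOf : ∀ y → neighbour (lab y) (slotOf y) ≡ lab (partner y)
  neighbour-slotOf y = proj₂ (neighbour-surjective (lab y) (lab (partner y)) (partner-edge y))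

  slot : Fin m → Fin K
  slot y = slotIndex (slotOf y)

  clusterVertex-slot : ∀ y → clusterVertex (lab y) (slot y) ≡ y
  clusterVertex-slot y =
    sym (clusterVertex-unique refl (trans (sym (neighbour-slotOf y)) (cong (neighbour (lab y)) (sym (indexSlot-slotIndex (slotOf y))))))

  slot-clusterVertex : ∀ v s → slot (clusterVertex v s) ≡ s
  slot-clusterVertex v s = trans (cong slotIndex slotOf≡) (slotIndex-indexSlot s)
    where
    c = clusterVertex v s
    slotOf≡ : slotOf c ≡ indexSlot s
    slotOf≡ = neighbour-injective v
                (trans (subst (λ u → neighbour u (slotOf c) ≡ lab (partner c)) (lab-clusterVertex v s) (neighbour-slotOf c))
                       (lab-partner-clusterVertex v s))

  clusterVertex-injective : ∀ v {s s′} → clusterVertex v s ≡ clusterVertex v s′ → s ≡ s′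
  clusterVertex-injective v {s} {s′} e = trans (sym (slot-clusterVertex v s)) (trans (cong slot e) (slot-clusterVertex v s′))

  same-cluster-slot⇒≡ : ∀ {y z} → lab y ≡ lab z → slot y ≡ slot z → y ≡ z
  same-cluster-slot⇒≡ {y} {z} l s = trans (sym (clusterVertex-slot y)) (trans (cong₂ clusterVertex l s) (clusterVertex-slot z))

  colour-slotOf : ∀ y → colour (lab y) (lab (partner y)) (partner-edge y) ≡ slotColour (slotOf y)
  colour-slotOf y = trans (colour-cong _ _ refl (sym (neighbour-slotOf y))) (neighbour-colour (lab y) (slotOf y))

  clusterVertex-injective₂ : ∀ {v v′ s s′} → clusterVertex v s ≡ clusterVertex v′ s′ → v ≡ v′ × s ≡ s′
  clusterVertex-injective₂ {v} {v′} {s} {s′} e =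
    trans (sym (lab-clusterVertex v s)) (trans (cong lab e) (lab-clusterVertex v′ s′)) ,
    trans (sym (slot-clusterVertex v s)) (trans (cong slot e) (slot-clusterVertex v′ s′))

  m≡n*K : m ≡ n * K
  m≡n*K = Finₚ.cantor-schröder-bernstein {f = λ y → combine (lab y) (slot y)} {g = uncurry clusterVertex ∘ Fin.remQuot K}
            (λ {y} {z} e → same-cluster-slot⇒≡ (Finₚ.combine-injectiveˡ (lab y) (slot y) (lab z) (slot z) e)
                                                (Finₚ.combine-injectiveʳ (lab y) (slot y) (lab z) (slot z) e))
            (λ e → let (v≡ , s≡) = clusterVertex-injective₂ e in remQuot-injective (cong₂ _,_ v≡ s≡))

  lab-partner≢lab : ∀ y → lab (partner y) ≢ lab y
  lab-partner≢lab y e with trans (sym (loopless (lab y))) (subst (λ u → X (lab y) u ≡ true) e (partner-edge y))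
  ... | ()

  adjacent-partner : ∀ y → completeTrunc T y (partner y) ≡ true
  adjacent-partner y with partner y Fin.≟ partner y
  ... | yes _ = refl
  ... | no ≢ = ⊥-elim (≢ refl)

  adjacent-cluster : ∀ {y z} → lab y ≡ lab z → y ≢ z → completeTrunc T y z ≡ true
  adjacent-cluster {y} {z} same y≢z with partner y Fin.≟ z | lab y Fin.≟ lab z | y Fin.≟ z
  ... | yes _ | _ | _ = refl
  ... | no _ | yes _ | no _ = refl
  ... | no _ | no ≢ | _ = ⊥-elim (≢ same)
  ... | no _ | yes _ | yes y≡z = ⊥-elim (y≢z y≡z)

  adjacent-cases : ∀ {y z} → completeTrunc T y z ≡ true → partner y ≡ z ⊎ (partner y ≢ z × lab y ≡ lab z × y ≢ z)
  adjacent-cases {y} {z} adj with partner y Fin.≟ z | lab y Fin.≟ lab z | y Fin.≟ z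
  ... | yes pe | _ | _ = inj₁ pe
  ... | no npe | yes same | no y≢z = inj₂ (npe , same , y≢z)
  adjacent-cases () | no _ | no _ | _
  adjacent-cases () | no _ | yes _ | yes _

  adjacent-sym : ∀ {y z} → completeTrunc T y z ≡ true → completeTrunc T z y ≡ true
  adjacent-sym {y} {z} adj with adjacent-cases adj
  ... | inj₁ refl = subst (λ w → completeTrunc T (partner y) w ≡ true) (partner-invol y) (adjacent-partner (partner y))
  ... | inj₂ (_ , same , y≢z) = adjacent-cluster (sym same) (y≢z ∘ sym)

  same-lab⇒¬partner : ∀ {y z} → lab y ≡ lab z → partner y ≢ z
  same-lab⇒¬partner {y} same pe = lab-partner≢lab y (trans (cong lab pe) (sym same))

  adjacent-¬partner⇒cluster : ∀ {y z} → completeTrunc T y z ≡ true → partner y ≢ z → lab y ≡ lab z × y ≢ z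
  adjacent-¬partner⇒cluster adj npe with adjacent-cases adj
  ... | inj₁ pe = ⊥-elim (npe pe)
  ... | inj₂ (_ , same , y≢z) = same , y≢z

  -- The neighbours of y are numbered by Fin K: its partner by slot y, a vertex z of its cluster by slot z.
  module Neighbourhood (y : Fin m) where

    indexAt : ∀ z → Dec (partner y ≡ z) → Fin K
    indexAt z (yes _) = slot y
    indexAt z (no _) = slot z

    index : Fin m → Fin K
    index z = indexAt z (partner y Fin.≟ z)

    index-injective : ∀ {z z′} → completeTrunc T y z ≡ true → completeTrunc T y z′ ≡ true → index z ≡ index z′ → z ≡ z′
    index-injective {z} {z′} adj adj′ = go (partner y Fin.≟ z) (partner y Fin.≟ z′)
      where
      go : ∀ d d′ → indexAt z d ≡ indexAt z′ d′ → z ≡ z′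
      go (yes pe) (yes pe′) _ = trans (sym pe) pe′
      go (yes _) (no npe′) s = let (same , y≢z′) = adjacent-¬partner⇒cluster adj′ npe′ in
                                 ⊥-elim (y≢z′ (same-cluster-slot⇒≡ same s))
      go (no npe) (yes _) s = let (same , y≢z) = adjacent-¬partner⇒cluster adj npe in
                                ⊥-elim (y≢z (same-cluster-slot⇒≡ same (sym s)))
      go (no npe) (no npe′) s = let (same , _) = adjacent-¬partner⇒cluster adj npe
                                    (same′ , _) = adjacent-¬partner⇒cluster adj′ npe′ in
                                same-cluster-slot⇒≡ (trans (sym same) same′) s

    vertex : Fin K → Fin m
    vertex s with s Fin.≟ slot y
    ... | yes _ = partner y
    ... | no _ = clusterVertex (lab y) s

    vertex-adjacent : ∀ s → completeTrunc T y (vertex s) ≡ true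
    vertex-adjacent s with s Fin.≟ slot y
    ... | yes _ = adjacent-partner y
    ... | no s≢ = adjacent-cluster (sym (lab-clusterVertex (lab y) s))
                    (λ e → s≢ (trans (sym (slot-clusterVertex (lab y) s)) (cong slot (sym e))))

    vertex-injective : Injective _≡_ _≡_ vertex
    vertex-injective {s} {s′} e with s Fin.≟ slot y | s′ Fin.≟ slot y
    ... | yes a | yes b = trans a (sym b)
    ... | yes _ | no _ = ⊥-elim (lab-partner≢lab y (trans (cong lab e) (lab-clusterVertex (lab y) s′)))
    ... | no _ | yes _ = ⊥-elim (lab-partner≢lab y (trans (cong lab (sym e)) (lab-clusterVertex (lab y) s)))
    ... | no _ | no _ = clusterVertex-injective (lab y) e

  regular : Regular (completeTrunc T) K
  regular y = trans (deg≡count (completeTrunc T) y)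
                (count≡ (completeTrunc T y) (λ z _ → index z) index-injective vertex vertex-adjacent vertex-injective)
    where open Neighbourhood y

  module _ (D : PathDecomposition r K) where
    open PathDecomposition D

    partner-adjacent : ∀ {y z} → partner y ≡ z → X (lab y) (lab z) ≡ true
    partner-adjacent {y} refl = partner-edge y

    truncColour : Fin m → Fin m → Maybe (Fin r)
    truncColour y z with partner y Fin.≟ z
    ... | yes pe = colour (lab y) (lab z) (partner-adjacent pe)
    ... | no _ = pathOf (slot y) (slot z)

    truncColour-partner : ∀ {y z} → partner y ≡ z → (p : X (lab y) (lab z) ≡ true) → truncColour y z ≡ colour (lab y) (lab z) p
    truncColour-partner {y} {z} pe p with partner y Fin.≟ z
    ... | yes _ = cong (colour _ _) (≡true-irrelevant _ p)
    ... | no npe = ⊥-elim (npe pe)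

    truncColour-cluster : ∀ {y z} → partner y ≢ z → truncColour y z ≡ pathOf (slot y) (slot z)
    truncColour-cluster {y} {z} npe with partner y Fin.≟ z
    ... | yes pe = ⊥-elim (npe pe)
    ... | no _ = refl

    truncColour-sym : ∀ y z → truncColour y z ≡ truncColour z y
    truncColour-sym y z with partner y Fin.≟ z | partner z Fin.≟ y
    ... | yes _ | yes _ = colour-sym (lab y) (lab z) _ _
    ... | yes pe | no npe = ⊥-elim (npe (trans (cong partner (sym pe)) (partner-invol y)))
    ... | no npe | yes pe = ⊥-elim (npe (trans (cong partner (sym pe)) (partner-invol z)))
    ... | no _ | no _ = pathOf-sym (slot y) (slot z)

    TruncClass : Maybe (Fin r) → Fin m → Fin m → Set
    TruncClass c y z = Σ (completeTrunc T y z ≡ true) λ _ → truncColour y z ≡ c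

    truncClass-sym : ∀ {c y z} → TruncClass c y z → TruncClass c z y
    truncClass-sym {y = y} {z} (adj , c) = adjacent-sym adj , trans (truncColour-sym z y) c

    module HamCycle (i : Fin r) where

      tour : Fin n → Fin K → Fin m
      tour p q = clusterVertex (order i p) (path i q)

      circuit : Fin (n * K) → Fin m
      circuit = uncurry tour ∘ Fin.remQuot K

      circuit-combine : ∀ p q → circuit (combine p q) ≡ tour p q
      circuit-combine p q = cong (uncurry tour) (Finₚ.remQuot-combine p q)

      circuit-injective : Injective _≡_ _≡_ circuit
      circuit-injective e =
        let (v≡ , s≡) = clusterVertex-injective₂ e
        in remQuot-injective (cong₂ _,_ (order-injective i v≡) (path-injective i s≡))


      indexSlot-path-first : ∀ {q} → toℕ q ≡ 0 → indexSlot (path i q) ≡ before i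
      indexSlot-path-first {q} q≡0 =
        trans (cong indexSlot (toℕ-injective (trans (path-start i q q≡0) (sym (toℕ-slotIndex-before i))))) (indexSlot-slotIndex (before i))

      indexSlot-path-last : ∀ {q} → suc (toℕ q) ≡ K → indexSlot (path i q) ≡ after i
      indexSlot-path-last {q} q-last =
        trans (cong indexSlot (toℕ-injective (trans (path-end i q q-last) (sym (toℕ-slotIndex-after i))))) (indexSlot-slotIndex (after i))

      partner-tour-last : ∀ {a b q q′} → Consec n a b → suc (toℕ q) ≡ K → toℕ q′ ≡ 0 → partner (tour a q) ≡ tour b q′
      partner-tour-last {a} {b} {q} {q′} a→b q-last q′-first = clusterVertex-unique lab-exit lab-back
        where
        lab-exit : lab (partner (tour a q)) ≡ order i b
        lab-exit = trans (lab-partner-clusterVertex _ _) (trans (cong (neighbour (order i a)) (indexSlot-path-last q-last)) (neighbour-after i a→b))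
        lab-back : lab (partner (partner (tour a q))) ≡ neighbour (order i b) (indexSlot (path i q′))
        lab-back = trans (cong lab (partner-invol (tour a q))) (trans (lab-clusterVertex _ _)
                     (sym (trans (cong (neighbour (order i b)) (indexSlot-path-first q′-first)) (neighbour-before i a→b))))

      tour-edge : ∀ {p q p′ q′} → Consec (n * K) (combine p q) (combine p′ q′) → TruncClass (just i) (tour p q) (tour p′ q′)
      tour-edge {p} {q} {p′} {q′} c with consec-combine⁻ {p = p} {p′ = p′} {q = q} {q′ = q′} c
      ... | inj₁ (refl , q→q′) =
        adjacent-cluster same y≢z , trans (truncColour-cluster (same-lab⇒¬partner same))
                                      (trans (cong₂ pathOf (slot-clusterVertex _ _) (slot-clusterVertex _ _)) (pathOf-path i q→q′))
        where
        same : lab (tour p q) ≡ lab (tour p q′)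
        same = trans (lab-clusterVertex _ _) (sym (lab-clusterVertex _ _))
        y≢z : tour p q ≢ tour p q′
        y≢z e = 1+n≢n (sym (trans (cong toℕ (path-injective i (clusterVertex-injective _ e))) (sym q→q′)))
      ... | inj₂ (q-last , q′-first , p→p′) =
        subst (λ z → completeTrunc T (tour p q) z ≡ true) pe (adjacent-partner _) ,
        trans (truncColour-partner pe (partner-adjacent pe))
              (trans (colour-cong _ (proj₁ cl) (lab-clusterVertex _ _) (lab-clusterVertex _ _)) (proj₂ cl))
        where
        pe = partner-tour-last p→p′ q-last q′-first
        cl = cyclicEdge⇒class i (p , p′ , p→p′ , inj₁ (refl , refl))

      0<K : 0 < K
      0<K = <-≤-trans (<-≤-trans (≤-<-trans z≤n (toℕ<n i)) (m≤m+n r r)) (m≤m+n (r + r) (bit e))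

      3≤n*K : 3 ≤ n * K
      3≤n*K = ≤-trans (proj₁ (cycles i)) (subst (_≤ n * K) (*-identityʳ n) (*-monoʳ-≤ n 0<K))

      firstK lastK : Fin K
      firstK = fromℕ< 0<K
      lastK = fromℕ< (subst (pred K <_) (suc-pred K {{ℕ.>-nonZero 0<K}}) (n<1+n (pred K)))

      lastK-last : suc (toℕ lastK) ≡ K
      lastK-last = trans (cong suc (toℕ-fromℕ< _)) (suc-pred K {{ℕ.>-nonZero 0<K}})

      circuit-edge : ∀ {ι ι′} → Consec (n * K) ι ι′ → TruncClass (just i) (circuit ι) (circuit ι′)
      circuit-edge {ι} {ι′} c =
        tour-edge (subst₂ (Consec (n * K)) (sym (Finₚ.combine-remQuot {n} K ι)) (sym (Finₚ.combine-remQuot {n} K ι′)) c)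

      m₀-edge-tour : ∀ {a b y} → Consec n a b → order i a ≡ lab y → order i b ≡ lab (partner y) →
                     y ≡ tour a lastK × partner y ≡ tour b firstK
      m₀-edge-tour {a} {b} {y} a→b fa≡y fb≡py = y≡ , trans (cong partner y≡) (partner-tour-last a→b lastK-last (toℕ-fromℕ< 0<K))
        where
        y≡ : y ≡ tour a lastK
        y≡ = clusterVertex-unique (sym fa≡y)
               (trans (sym fb≡py) (sym (trans (cong (neighbour (order i a)) (indexSlot-path-last lastK-last)) (neighbour-after i a→b))))

      tour-position : ∀ {v w q} → lab w ≡ v → path i q ≡ slot w → tour (position i v) q ≡ w
      tour-position {v} {w} refl e = trans (cong₂ clusterVertex (order-position i v) e) (clusterVertex-slot w)

      truncClass⇒cyclicEdge : ∀ {y z} → TruncClass (just i) y z → CyclicEdge circuit y z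
      truncClass⇒cyclicEdge {y} {z} (adj , col) with adjacent-cases adj
      ... | inj₁ pe with class⇒cyclicEdge i (partner-adjacent pe , trans (sym (truncColour-partner pe (partner-adjacent pe))) col)
      ...   | a , b , a→b , inj₁ (fa≡y , fb≡z) =
        let (y≡ , py≡) = m₀-edge-tour a→b fa≡y (trans fb≡z (cong lab (sym pe)))
        in combine a lastK , combine b firstK , consec-combine-outer lastK-last (toℕ-fromℕ< 0<K) a→b ,
           inj₁ (trans (circuit-combine a lastK) (sym y≡) , trans (circuit-combine b firstK) (trans (sym py≡) pe))
      ...   | a , b , a→b , inj₂ (fa≡z , fb≡y) =
        let (z≡ , pz≡) = m₀-edge-tour a→b fa≡z (trans fb≡y (cong lab (sym (trans (cong partner (sym pe)) (partner-invol y)))))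
        in combine a lastK , combine b firstK , consec-combine-outer lastK-last (toℕ-fromℕ< 0<K) a→b ,
           inj₂ (trans (circuit-combine a lastK) (sym z≡) ,
                 trans (circuit-combine b firstK) (trans (sym pz≡) (trans (cong partner (sym pe)) (partner-invol y))))
      truncClass⇒cyclicEdge {y} {z} (adj , col) | inj₂ (npe , same , y≢z)
        with path-pathOf (y≢z ∘ same-cluster-slot⇒≡ same) (trans (sym (truncColour-cluster npe)) col)
      ... | q , q′ , q→q′ , hit = combine P q , combine P q′ , consec-combine-inner P q→q′ , at hit
        where
        P = position i (lab y)
        at : (path i q ≡ slot y × path i q′ ≡ slot z) ⊎ (path i q ≡ slot z × path i q′ ≡ slot y) →
             (circuit (combine P q) ≡ y × circuit (combine P q′) ≡ z) ⊎ (circuit (combine P q) ≡ z × circuit (combine P q′) ≡ y)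
        at (inj₁ (qy , q′z)) = inj₁ (trans (circuit-combine P q) (tour-position refl qy) ,
                                     trans (circuit-combine P q′) (tour-position (sym same) q′z))
        at (inj₂ (qz , q′y)) = inj₂ (trans (circuit-combine P q) (tour-position (sym same) qz) ,
                                     trans (circuit-combine P q′) (tour-position refl q′y))

      truncClass⇔cyclicEdge : ∀ y z → TruncClass (just i) y z ⇔ CyclicEdge circuit y z
      truncClass⇔cyclicEdge y z = mk⇔ truncClass⇒cyclicEdge from
        where
        from : CyclicEdge circuit y z → TruncClass (just i) y z
        from (ι , ι′ , c , inj₁ (ιy , ι′z)) = subst₂ (TruncClass (just i)) ιy ι′z (circuit-edge c)
        from (ι , ι′ , c , inj₂ (ιz , ι′y)) = truncClass-sym (subst₂ (TruncClass (just i)) ιz ι′y (circuit-edge c))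

      hamCycle : IsHamCycle m (TruncClass (just i))
      hamCycle = hamCycle-reindex m≡n*K (TruncClass (just i)) circuit 3≤n*K circuit-injective truncClass⇔cyclicEdge

    truncClass-nothing-empty : (∀ u v → ¬ Class nothing u v) → CoversAllEdges D → ∀ y z → ¬ TruncClass nothing y z
    truncClass-nothing-empty none covers y z (adj , col) with adjacent-cases adj
    ... | inj₁ pe = none (lab y) (lab z) (partner-adjacent pe , trans (sym (truncColour-partner pe (partner-adjacent pe))) col)
    ... | inj₂ (npe , same , y≢z) = covers (slot y) (slot z) (y≢z ∘ same-cluster-slot⇒≡ same) (trans (sym (truncColour-cluster npe)) col)

    m₀-colour : ∀ {y w} (pe : partner y ≡ w) → truncColour y w ≡ slotColour (slotOf y)
    m₀-colour {y} pe = trans (truncColour-partner pe (partner-adjacent pe))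
                         (trans (colour-cong _ (partner-edge y) refl (cong lab (sym pe))) (colour-slotOf y))

    -- A vertex in a cycle slot is matched inside its cluster by an unused edge of D; a vertex in the
    -- matched slot is matched by its M₀-edge, which comes from the perfect matching of X.
    module Matching (leavesMatching : LeavesMatching D) where

      mate = proj₁ leavesMatching
      unused⇒mate = proj₁ (proj₂ leavesMatching)
      mate-unused = proj₂ (proj₂ leavesMatching)

      clusterMate : Fin m → Fin m
      clusterMate y = clusterVertex (lab y) (mate (slot y))

      unusedClusterEdge : ∀ {y w} → TruncClass nothing y w → partner y ≢ w → toℕ (slot y) < r + r × w ≡ clusterMate y
      unusedClusterEdge {y} {w} (adj , col) npe =
        let (same , y≢w) = adjacent-¬partner⇒cluster adj npe
            (y<2r , w≡) = unused⇒mate (slot y) (slot w) (y≢w ∘ same-cluster-slot⇒≡ same) (trans (sym (truncColour-cluster npe)) col)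
        in y<2r , trans (sym (clusterVertex-slot w)) (cong₂ clusterVertex (sym same) w≡)

      matchedInCluster : ∀ {y} → toℕ (slot y) < r + r →
                         TruncClass nothing y (clusterMate y) × (∀ w → TruncClass nothing y w → w ≡ clusterMate y)
      matchedInCluster {y} y<2r = (adjacent-cluster same y≢z , trans (truncColour-cluster (same-lab⇒¬partner same)) mate-col) , unique
        where
        same : lab y ≡ lab (clusterMate y)
        same = sym (lab-clusterVertex _ _)
        y≢z : y ≢ clusterMate y
        y≢z y≡z = proj₂ (mate-unused (slot y) y<2r) (trans (sym (slot-clusterVertex (lab y) _)) (cong slot (sym y≡z)))
        mate-col : pathOf (slot y) (slot (clusterMate y)) ≡ nothing
        mate-col = trans (cong (pathOf (slot y)) (slot-clusterVertex (lab y) _)) (proj₁ (mate-unused (slot y) y<2r))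
        unique : ∀ w → TruncClass nothing y w → w ≡ clusterMate y
        unique w (adj , col) with adjacent-cases adj
        ... | inj₁ pe = ⊥-elim (just≢nothing (trans (sym (proj₂ (slotIndex-<⇒colour (slotOf y) y<2r))) (trans (sym (m₀-colour pe)) col)))
        ... | inj₂ (npe , _) = proj₂ (unusedClusterEdge (adj , col) npe)

      matchedByPartner : ∀ {y} → ¬ toℕ (slot y) < r + r →
                         TruncClass nothing y (partner y) × (∀ w → TruncClass nothing y w → w ≡ partner y)
      matchedByPartner {y} y≮2r = (adjacent-partner y , trans (m₀-colour refl) matched-colour) , unique
        where
        matched-colour : slotColour (slotOf y) ≡ nothing
        matched-colour with slotColour (slotOf y) in c
        ... | just i = ⊥-elim (y≮2r (colour⇒slotIndex-< c))
        ... | nothing = refl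
        unique : ∀ w → TruncClass nothing y w → w ≡ partner y
        unique w (adj , col) with adjacent-cases adj
        ... | inj₁ pe = sym pe
        ... | inj₂ (npe , _) = ⊥-elim (y≮2r (proj₁ (unusedClusterEdge (adj , col) npe)))

      truncClass-nothing-matching : IsPerfectMatching m (TruncClass nothing)
      truncClass-nothing-matching y with toℕ (slot y) <? r + r
      ... | yes y<2r = clusterMate y , matchedInCluster y<2r
      ... | no y≮2r = partner y , matchedByPartner y≮2r

    hamDecomposable : ((K % 2 ≡ 0) × (∀ y z → ¬ TruncClass nothing y z)) ⊎ ((K % 2 ≡ 1) × IsPerfectMatching m (TruncClass nothing)) →
                      HamDecomposable (completeTrunc T)
    hamDecomposable rest = K , regular , record
      { r = r
      ; colour = λ y z _ → truncColour y z
      ; colour-sym = λ y z _ _ → truncColour-sym y z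
      ; cycles = HamCycle.hamCycle
      ; rest = rest
      }

twice+bit%2 : ∀ r e → ((r + r) + bit e) % 2 ≡ bit e
twice+bit%2 r e = begin
  ((r + r) + bit e) % 2  ≡⟨ cong (_% 2) (+-comm (r + r) (bit e)) ⟩
  (bit e + (r + r)) % 2  ≡⟨ cong (λ z → (bit e + z) % 2) (trans (cong (r +_) (sym (+-identityʳ r))) (*-comm 2 r)) ⟩
  (bit e + r * 2) % 2    ≡⟨ [m+kn]%n≡m%n (bit e) r 2 ⟩
  bit e % 2              ≡⟨ bit%2 e ⟩
  bit e                  ∎
  where
  open ≡-Reasoning
  bit%2 : ∀ e → bit e % 2 ≡ bit e
  bit%2 false = refl
  bit%2 true = refl

truncation-hamDecomposable : ∀ {n m k} (X : Adj n) → (∀ u → X u u ≡ false) → (HD : HamDecomposition X k) →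
                             ∀ e → Leftover e (HamDecomposition.Class HD nothing) → (T : GenTruncData X m) →
                             HamDecomposable (completeTrunc T)
truncation-hamDecomposable X loopless HD false none T =
  hamDecomposable D (inj₁ (twice+bit%2 r false , truncClass-nothing-empty D none covers))
  where
  open HamDecomposition HD using (r)
  open Truncation X loopless HD false none T
  D = proj₁ (walecki r false)
  covers = proj₂ (walecki r false)
truncation-hamDecomposable X loopless HD true pm T =
  hamDecomposable D (inj₂ (twice+bit%2 r true , Matching.truncClass-nothing-matching D leavesMatching))
  where
  open HamDecomposition HD using (r)
  open Truncation X loopless HD true pm T
  D = proj₁ (walecki r true)
  leavesMatching = proj₂ (walecki r true)

theorem5p4 : ∀ {n m : ℕ} (X : Adj n) → IsSimple X → NoIsolated X →
    HamDecomposable X → (T : GenTruncData X m) →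
    HamDecomposable (completeTrunc T)
theorem5p4 X (_ , loopless) _ (k , _ , HD) T with HamDecomposition.rest HD
... | inj₁ (_ , none) = truncation-hamDecomposable X loopless HD false none T
... | inj₂ (_ , pm) = truncation-hamDecomposable X loopless HD true pm T
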